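{- Let $\mathcal{C}\le\mathcal{G}=\mathbb{Z}_2^{k_1}\times\mathbb{Z}_4^{k_2}\times Q_8^{k_3}$ be such that $C=\Phi(\mathcal{C})$ is a binary Hadamard code of length $n=2^m$, with standard generators and subgroup $\mathcal{R}(\mathcal{C})$ as in the context. Let $a,b\in\mathcal{R}(\mathcal{C})\setminus T(\mathcal{C})$ with $ba^{ -1}\notin T(\mathcal{C})$. Then: (1) $a^2,b^2,(ab)^2\notin\{\mathbf{e},\mathbf{u}\}$ and $\mathrm{wt}(a^2)=\mathrm{wt}(b^2)=\mathrm{wt}((ab)^2)=n/2$; (2) $\mathrm{wt}((a\colon b))=n/4$, and hence $(a\colon b)\notin\mathcal{C}$; (3) if $a',b'$ is a different pair satisfying the same hypotheses as $a,b$, such that the distinct elements of $\{a,b,a',b'\}$ lie pairwise in different cosets of $T(\mathcal{C})$, then $(a\colon b)\ne(a'\colon b')$.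
   Context: $Q_8=\langle \mathbf{a},\mathbf{b} : \mathbf{a}^4=\mathbf{a}^2\mathbf{b}^2=\mathbf{1},\ \mathbf{b}\mathbf{a}\mathbf{b}^{ -1}=\mathbf{a}^{ -1}\rangle$; $\mathcal{G}$ is written multiplicatively with identity $\mathbf{e}$, and $\mathbf{u}=(1,\dots,1,2,\dots,2,\mathbf{a}^2,\dots,\mathbf{a}^2)$. The Gray map $\Phi$ acts componentwise: identity on $\mathbb{Z}_2$; $0\mapsto00,1\mapsto01,2\mapsto11,3\mapsto10$ on $\mathbb{Z}_4$; $\mathbf{1}\mapsto0000$, $\mathbf{b}\mapsto0110$, $\mathbf{a}\mapsto0101$, $\mathbf{a}\mathbf{b}\mapsto1100$, $\mathbf{a}^2\mapsto1111$, $\mathbf{a}^2\mathbf{b}\mapsto1001$, $\mathbf{a}^3\mapsto1010$, $\mathbf{a}^3\mathbf{b}\mapsto0011$ on $Q_8$. For $x\in\mathcal{G}$, $\mathrm{wt}(x)$ is the Hamming weight of $\Phi(x)$. A binary Hadamard code of length $n$ is the set of rows of a normalized binary Hadamard matrix of order $n$ together with their complements. $T(\mathcal{C})$ is the subgroup of elements of $\mathcal{C}$ of order $\le 2$, $|T(\mathcal{C})|=2^\sigma$; $Z(\mathcal{C})$ is the center; $[a,b]$ is the commutator, $ab=[a,b]ba$. Swapper: for $a,b\in\mathcal{G}$, $(a\colon b)$ is the element of order $\le2$ of $\mathcal{G}$ computed componentwise: $0$ on $\mathbb{Z}_2$-components; on a $\mathbb{Z}_4$-component it is $2$ if both entries are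 odd and $0$ otherwise; on a $Q_8$-component, with classes $P_0=\{\mathbf{1},\mathbf{a}^2\}$, $P_1=\{\mathbf{a},\mathbf{a}^3\}$, $P_2=\{\mathbf{b},\mathbf{a}^2\mathbf{b}\}$, $P_3=\{\mathbf{a}\mathbf{b},\mathbf{a}^3\mathbf{b}\}$, it is $\mathbf{a}^2$ if the pair of entries lies in $P_1\times P_1$, $P_1\times P_2$, $P_2\times P_2$, $P_2\times P_3$, $P_3\times P_1$ or $P_3\times P_3$, and $\mathbf{1}$ otherwise. It satisfies $\Phi((a\colon b)ab)=\Phi(a)+\Phi(b)$. Normalized generators (from earlier work): $\mathcal{C}=\langle x_1,\dots,x_\sigma;y_1,\dots,y_\delta;z_1,\dots,z_\rho\rangle$ with $T(\mathcal{C})=\langle x_i\rangle$, $Z(\mathcal{C})=\langle x_i,y_j\rangle$, $|Z(\mathcal{C})/T(\mathcal{C})|=2^\delta$, $|\mathcal{C}/Z(\mathcal{C})|=2^\rho$, and $\mathcal{C}$ has one of the shapes: (1) $\rho=0$, $\mathbf{u}$ not a square in $\mathcal{C}$; (1*) $\rho=0$, $\mathbf{u}$ a square of an element of $\mathcal{C}$; (2) $\delta=0$, $z_1^2=z_2^2=[z_1,z_2]=\mathbf{u}$, $[z_i,z_j]=z_j^2$, $[z_j,z_k]=\mathbf{e}$ ($i\in\{1,2\}$, $3\le j,k\le\rho$); (3) $\delta=0$, $z_1^2=\mathbf{u}\notin\langle z_2^2,\dots,z_\rho^2\rangle$, $[z_1,z_i]=z_i^2$, $[z_i,z_j]=\mathbf{e}$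 ($i\ne j\in\{2,\dots,\rho\}$); (4) $\delta=0$, $\rho=2$, $z_1^2=z_2^2=[z_1,z_2]\ne\mathbf{u}$; (4*) $\delta=1$, $\rho=2$, $z_1^2=z_2^2=[z_1,z_2]\ne\mathbf{u}$; (5) $\delta=0$, $\rho=4$, $z_1^2=z_2^2=[z_1,z_2]=\mathbf{u}\ne z_3^2=z_4^2=[z_3,z_4]$, $[z_i,z_j]\in\langle z_j^2\rangle$ ($i\in\{1,2\}$, $j\in\{3,4\}$). Standard generators $x_1,\dots,x_\sigma;r_1,\dots,r_\tau;s_1,\dots,s_\upsilon$: shapes 1, 1*: $\upsilon=0$, $r_j$ are elements of order four with $\mathcal{C}=\langle x_i,r_j\rangle$, $|\mathcal{C}/T(\mathcal{C})|=2^\tau$, chosen with $r_1^2=\mathbf{u}$ when $\mathbf{u}$ is a square in $\mathcal{C}$; shape 2: $r_1=z_1z_2$, $r_i=z_{i+1}$ ($2\le i\le\tau=\rho-1$), $s_1=z_1$; shape 3: $r_i=z_{i+1}$ ($1\le i\le\tau=\rho-1$), $s_1=z_1$; shape 4: $r_1=z_1$, $s_1=z_2$; shape 4*: $r_1=y_1z_1$, $r_2=z_1$, $s_1=z_2$; shape 5: $r_1=z_1$, $r_2=f(z_1)$, $s_1=z_2$, $s_2=f(z_2)$, where $f(z)=z_3$ if $[z,z_3]=\mathbf{e}$, $z_4$ if $[z,z_4]=\mathbf{e}$, $z_3z_4$ otherwise. $\mathcal{A}(\mathcal{C})=\langle x_i,r_j\rangle$. $\mathcal{R}(\mathcal{C})=\langle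 x_1,\dots,x_\sigma,r_2,\dots,r_\tau\rangle$ if $r_1^2=\mathbf{u}$, and $\mathcal{R}(\mathcal{C})=\mathcal{A}(\mathcal{C})$ if $r_1^2\ne\mathbf{u}$. -}

module Defs where

open import Data.Bool using (Bool; true; false; _∧_; _∨_; not; _xor_; if_then_else_)
open import Data.Nat using (ℕ; zero; suc; _+_; _*_; _^_)
open import Data.Fin using (Fin)
import Data.Fin as F
open import Data.Integer using (ℤ; +_; -[1+_]) renaming (_+_ to _+ℤ_; _*_ to _*ℤ_)
open import Data.List using (List; []; _∷_; _++_; map; concatMap; length)
open import Data.List.Membership.Propositional using (_∈_)
open import Data.Vec using (Vec; []; _∷_; zipWith; tabulate; toList)
import Data.Vec as V
open import Data.Product using (_×_; _,_; ∃; ∃-syntax; Σ)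
open import Data.Sum using (_⊎_)
open import Relation.Binary.PropositionalEquality using (_≡_; _≢_)
open import Relation.Nullary using (¬_)

data Z4 : Set where
  z0 z1 z2 z3 : Z4

suc4 : Z4 → Z4
suc4 z0 = z1
suc4 z1 = z2
suc4 z2 = z3
suc4 z3 = z0

_+₄_ : Z4 → Z4 → Z4
z0 +₄ y = y
z1 +₄ y = suc4 y
z2 +₄ y = suc4 (suc4 y)
z3 +₄ y = suc4 (suc4 (suc4 y))

neg4 : Z4 → Z4
neg4 z0 = z0
neg4 z1 = z3
neg4 z2 = z2
neg4 z3 = z1

odd4 : Z4 → Bool
odd4 z0 = false
odd4 z1 = true
odd4 z2 = false
odd4 z3 = true

eq4 : Z4 → Z4 → Bool
eq4 z0 z0 = true
eq4 z1 z1 = true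
eq4 z2 z2 = true
eq4 z3 z3 = true
eq4 _ _ = false

-- The quaternion group Q8: the element  a^i b^j  is  q i j
-- (i ∈ Z4, j ∈ {0,1} encoded as Bool).  Relations a^4 = 1, b^2 = a^2,
-- b a b^-1 = a^-1 give  (a^i b^j)(a^k b^l) = a^(i + (-1)^j k + 2jl) b^(j+l).

record Q8 : Set where
  constructor q
  field
    ex : Z4
    bp : Bool

_·₈_ : Q8 → Q8 → Q8
q i j ·₈ q k l =
  q (i +₄ ((if j then neg4 k else k) +₄ (if j ∧ l then z2 else z0))) (j xor l)

inv₈ : Q8 → Q8
inv₈ (q i false) = q (neg4 i) false
inv₈ (q i true)  = q (i +₄ z2) true

eq8 : Q8 → Q8 → Bool
eq8 (q i j) (q k l) = eq4 i k ∧ (if j then l else not l)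

𝟏₈ a²₈ : Q8
𝟏₈ = q z0 false
a²₈ = q z2 false

record G (k1 k2 k3 : ℕ) : Set where
  constructor g
  field
    c2 : Vec Bool k1
    c4 : Vec Z4 k2
    c8 : Vec Q8 k3

eqVec : {A : Set} {k : ℕ} → (A → A → Bool) → Vec A k → Vec A k → Bool
eqVec _ [] [] = true
eqVec f (x ∷ xs) (y ∷ ys) = f x y ∧ eqVec f xs ys

gray4 : Z4 → List Bool
gray4 z0 = false ∷ false ∷ []
gray4 z1 = false ∷ true ∷ []
gray4 z2 = true ∷ true ∷ []
gray4 z3 = true ∷ false ∷ []

gray8 : Q8 → List Bool
gray8 (q z0 false) = false ∷ false ∷ false ∷ false ∷ []
gray8 (q z0 true)  = false ∷ true ∷ true ∷ false ∷ []
gray8 (q z1 false) = false ∷ true ∷ false ∷ true ∷ []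
gray8 (q z1 true)  = true ∷ true ∷ false ∷ false ∷ []
gray8 (q z2 false) = true ∷ true ∷ true ∷ true ∷ []
gray8 (q z2 true)  = true ∷ false ∷ false ∷ true ∷ []
gray8 (q z3 false) = true ∷ false ∷ true ∷ false ∷ []
gray8 (q z3 true)  = false ∷ false ∷ true ∷ true ∷ []

ones : List Bool → ℕ
ones [] = 0
ones (true ∷ bs) = suc (ones bs)
ones (false ∷ bs) = ones bs

swap4 : Z4 → Z4 → Z4
swap4 s t = if odd4 s ∧ odd4 t then z2 else z0

data Cls : Set where
  P0 P1 P2 P3 : Cls

cls : Q8 → Cls
cls (q i false) = if odd4 i then P1 else P0
cls (q i true)  = if odd4 i then P3 else P2

swapCls : Cls → Cls → Bool
swapCls P1 P1 = true
swapCls P1 P2 = true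
swapCls P2 P2 = true
swapCls P2 P3 = true
swapCls P3 P1 = true
swapCls P3 P3 = true
swapCls _ _ = false

swap8 : Q8 → Q8 → Q8
swap8 s t = if swapCls (cls s) (cls t) then a²₈ else 𝟏₈

allVec : {A : Set} → List A → (k : ℕ) → List (Vec A k)
allVec xs zero = [] ∷ []
allVec xs (suc k) = concatMap (λ x → map (x ∷_) (allVec xs k)) xs

allZ4 : List Z4
allZ4 = z0 ∷ z1 ∷ z2 ∷ z3 ∷ []

allQ8 : List Q8
allQ8 = concatMap (λ i → q i false ∷ q i true ∷ []) allZ4

countL : {A : Set} → (A → Bool) → List A → ℕ
countL p [] = 0
countL p (x ∷ xs) = if p x then suc (countL p xs) else countL p xs

allL : {A : Set} → (A → Bool) → List A → Bool
allL p [] = true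
allL p (x ∷ xs) = p x ∧ allL p xs

module _ {k1 k2 k3 : ℕ} where

  infixl 7 _·_

  _·_ : G k1 k2 k3 → G k1 k2 k3 → G k1 k2 k3
  g x y z · g x' y' z' = g (zipWith _xor_ x x') (zipWith _+₄_ y y') (zipWith _·₈_ z z')

  _⁻¹ : G k1 k2 k3 → G k1 k2 k3
  g x y z ⁻¹ = g x (V.map neg4 y) (V.map inv₈ z)

  e : G k1 k2 k3
  e = g (V.replicate _ false) (V.replicate _ z0) (V.replicate _ 𝟏₈)

  u : G k1 k2 k3
  u = g (V.replicate _ true) (V.replicate _ z2) (V.replicate _ a²₈)

  sq : G k1 k2 k3 → G k1 k2 k3
  sq x = x · x

  -- commutator, so that  x y = [x,y] y x
  [_,_] : G k1 k2 k3 → G k1 k2 k3 → G k1 k2 k3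
  [ x , y ] = x · y · x ⁻¹ · y ⁻¹

  infix 4 _==_
  _==_ : G k1 k2 k3 → G k1 k2 k3 → Bool
  g x y z == g x' y' z' =
    eqVec (λ s t → if s then t else not t) x x' ∧ eqVec eq4 y y' ∧ eqVec eq8 z z'

  Φ : G k1 k2 k3 → List Bool
  Φ (g x y z) = toList x ++ concatMap gray4 (toList y) ++ concatMap gray8 (toList z)

  wt : G k1 k2 k3 → ℕ
  wt x = ones (Φ x)

  ⟪_∶_⟫ : G k1 k2 k3 → G k1 k2 k3 → G k1 k2 k3
  ⟪ g x y z ∶ g x' y' z' ⟫ =
    g (V.replicate _ false) (zipWith swap4 y y') (zipWith swap8 z z')

  allG : List (G k1 k2 k3)
  allG = concatMap (λ x → concatMap (λ y → map (g x y) (allVec allQ8 k3))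
                                    (allVec allZ4 k2))
                   (allVec (false ∷ true ∷ []) k1)

  SubsetG : Set
  SubsetG = G k1 k2 k3 → Bool

  ∣_∣ : SubsetG → ℕ
  ∣ P ∣ = countL P allG

  _∈G_ : G k1 k2 k3 → SubsetG → Set
  x ∈G P = P x ≡ true

  _∉G_ : G k1 k2 k3 → SubsetG → Set
  x ∉G P = P x ≡ false

  IsSubgroup : SubsetG → Set
  IsSubgroup C = (e ∈G C)
               × (∀ x y → x ∈G C → y ∈G C → (x · y) ∈G C)
               × (∀ x → x ∈G C → (x ⁻¹) ∈G C)

  Tor : SubsetG → SubsetG
  Tor C x = C x ∧ (x · x == e)

  Cen : SubsetG → SubsetG
  Cen C x = C x ∧ allL (λ y → not (C y) ∨ (x · y == y · x)) allG

  data ⟨_⟩ (S : List (G k1 k2 k3)) : G k1 k2 k3 → Set where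
    gen-e   : ⟨ S ⟩ e
    gen-mul : ∀ {s x} → s ∈ S → ⟨ S ⟩ x → ⟨ S ⟩ (s · x)
    gen-inv : ∀ {s x} → s ∈ S → ⟨ S ⟩ x → ⟨ S ⟩ ((s ⁻¹) · x)

  Generates : List (G k1 k2 k3) → SubsetG → Set
  Generates S P = ∀ x → (x ∈G P → ⟨ S ⟩ x) × (⟨ S ⟩ x → x ∈G P)

  NormGens : SubsetG → (xs ys zs : List (G k1 k2 k3)) → Set
  NormGens C xs ys zs =
      Generates (xs ++ ys ++ zs) C
    × Generates xs (Tor C) × ∣ Tor C ∣ ≡ 2 ^ length xs
    × Generates (xs ++ ys) (Cen C) × ∣ Cen C ∣ ≡ 2 ^ length ys * ∣ Tor C ∣
    × ∣ C ∣ ≡ 2 ^ length zs * ∣ Cen C ∣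

  f5 : (w₃ w₄ w : G k1 k2 k3) → G k1 k2 k3
  f5 w₃ w₄ w = if [ w , w₃ ] == e then w₃ else (if [ w , w₄ ] == e then w₄ else w₃ · w₄)

  data Standard (C : SubsetG) : (xs rs ss : List (G k1 k2 k3)) → Set where
    shape1 : ∀ {xs ys rs}
      → NormGens C xs ys []
      → (∀ r → r ∈ rs → (sq (sq r) ≡ e) × (sq r ≢ e))
      → Generates (xs ++ rs) C
      → ∣ C ∣ ≡ 2 ^ length rs * ∣ Tor C ∣
      → ((∃[ c ] (c ∈G C × sq c ≡ u)) → ∃[ r₁ ] ∃[ rs' ] (rs ≡ r₁ ∷ rs' × sq r₁ ≡ u))
      → Standard C xs rs []
    shape2 : ∀ {xs z₁ z₂ ws}
      → NormGens C xs [] (z₁ ∷ z₂ ∷ ws)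
      → sq z₁ ≡ u → sq z₂ ≡ u → [ z₁ , z₂ ] ≡ u
      → (∀ w → w ∈ ws → ([ z₁ , w ] ≡ sq w) × ([ z₂ , w ] ≡ sq w))
      → (∀ w w' → w ∈ ws → w' ∈ ws → [ w , w' ] ≡ e)
      → Standard C xs (z₁ · z₂ ∷ ws) (z₁ ∷ [])
    shape3 : ∀ {xs z₁ ws}
      → NormGens C xs [] (z₁ ∷ ws)
      → sq z₁ ≡ u → ¬ ⟨ map sq ws ⟩ u
      → (∀ w → w ∈ ws → [ z₁ , w ] ≡ sq w)
      → (∀ w w' → w ∈ ws → w' ∈ ws → [ w , w' ] ≡ e)
      → Standard C xs ws (z₁ ∷ [])
    shape4 : ∀ {xs z₁ z₂}
      → NormGens C xs [] (z₁ ∷ z₂ ∷ [])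
      → sq z₁ ≡ sq z₂ → sq z₂ ≡ [ z₁ , z₂ ] → sq z₁ ≢ u
      → Standard C xs (z₁ ∷ []) (z₂ ∷ [])
    shape4* : ∀ {xs y₁ z₁ z₂}
      → NormGens C xs (y₁ ∷ []) (z₁ ∷ z₂ ∷ [])
      → sq z₁ ≡ sq z₂ → sq z₂ ≡ [ z₁ , z₂ ] → sq z₁ ≢ u
      → Standard C xs (y₁ · z₁ ∷ z₁ ∷ []) (z₂ ∷ [])
    shape5 : ∀ {xs z₁ z₂ z₃ z₄}
      → NormGens C xs [] (z₁ ∷ z₂ ∷ z₃ ∷ z₄ ∷ [])
      → sq z₁ ≡ u → sq z₂ ≡ u → [ z₁ , z₂ ] ≡ u
      → u ≢ sq z₃ → sq z₃ ≡ sq z₄ → sq z₄ ≡ [ z₃ , z₄ ]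
      → ⟨ sq z₃ ∷ [] ⟩ [ z₁ , z₃ ] → ⟨ sq z₄ ∷ [] ⟩ [ z₁ , z₄ ]
      → ⟨ sq z₃ ∷ [] ⟩ [ z₂ , z₃ ] → ⟨ sq z₄ ∷ [] ⟩ [ z₂ , z₄ ]
      → Standard C xs (z₁ ∷ f5 z₃ z₄ z₁ ∷ []) (z₂ ∷ f5 z₃ z₄ z₂ ∷ [])

  Rgens : (xs rs : List (G k1 k2 k3)) → List (G k1 k2 k3)
  Rgens xs [] = xs
  Rgens xs (r₁ ∷ rs) = if sq r₁ == u then xs ++ rs else xs ++ (r₁ ∷ rs)

  R : (xs rs : List (G k1 k2 k3)) → G k1 k2 k3 → Set
  R xs rs = ⟨ Rgens xs rs ⟩

sumFin : (n : ℕ) → (Fin n → ℤ) → ℤ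
sumFin zero f = + 0
sumFin (suc n) f = f F.zero +ℤ sumFin n (λ i → f (F.suc i))

IsNormHadamard : (n : ℕ) → (Fin n → Fin n → ℤ) → Set
IsNormHadamard n H =
    (∀ i j → H i j ≡ + 1 ⊎ H i j ≡ -[1+ 0 ])
  × (∀ i → sumFin n (λ k → H i k *ℤ H i k) ≡ + n)
  × (∀ i j → i ≢ j → sumFin n (λ k → H i k *ℤ H j k) ≡ + 0)
  × (∀ i j → F.toℕ i ≡ 0 ⊎ F.toℕ j ≡ 0 → H i j ≡ + 1)

toBit : ℤ → Bool
toBit (+ _) = false
toBit -[1+ _ ] = true

row : {n : ℕ} → (Fin n → Fin n → ℤ) → Fin n → List Bool
row H i = toList (tabulate (λ k → toBit (H i k)))

IsHadamardCode : (n : ℕ) → (List Bool → Set) → Set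
IsHadamardCode n S =
  ∃[ H ] (IsNormHadamard n H
          × (∀ v → S v → ∃[ i ] (v ≡ row H i ⊎ v ≡ map not (row H i)))
          × (∀ i → S (row H i) × S (map not (row H i))))

ΦImage : {k1 k2 k3 : ℕ} → SubsetG {k1} {k2} {k3} → List Bool → Set
ΦImage C v = ∃[ c ] (c ∈G C × Φ c ≡ v)

module Submission where

-- Because Φ(C) is a Hadamard code, every element of C other than e and u
-- (of weights 0 and n) has weight n/2. G is a product of copies of Z2, Z4 and Q8, so the
-- identities linking products, squares, commutators, the swapper and the Gray weight hold
-- factorwise and are checked there by enumeration; the key one is
-- wt(x²) + wt(y²) = wt((xy)²) + 2 wt((x:y)) for commuting x and y.
-- For every shape of standard generators, R(C) is an abelian subgroup of C in which u is not
-- a square: a square root of u would make a generator redundant and force |C/T(C)| below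
-- its prescribed size. So for a, b as in the statement, a², b² and (ab)² differ from e and u
-- and weigh n/2, whence wt((a:b)) = n/4, not a codeword weight. If (a:b) = (a':b'), a second
-- swapper identity gives wt((aa':b)) = 0, and then (aa'b)² would weigh n, i.e. equal u.

open import Defs
open import Data.Bool using (Bool; true; false; _∧_; _∨_; not; _xor_; if_then_else_; T)
import Data.Bool.Properties as Bool
open import Data.Nat using (ℕ; zero; suc; _+_; _*_; _^_; _≤_; z≤n; s≤s)
import Data.Nat.Properties as ℕ
open import Data.Nat.DivMod using (_/_; m*n/n≡m)
open import Data.Nat.Tactic.RingSolver using (solve-∀)
open import Data.Fin using (Fin)
import Data.Fin.Properties as Fin
open import Data.List using (List; []; _∷_; _++_; map; concatMap; length; filterᵇ)
import Data.List.Properties as List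
open import Data.List.Membership.Propositional using (_∈_)
open import Data.List.Membership.Propositional.Properties
  using (∈-map⁺; ∈-map⁻; ∈-∃++; ∈-filter⁺; ∈-concatMap⁺; ∈-concatMap⁻; ∈-++⁻; ∈-++⁺ˡ; ∈-++⁺ʳ)
open import Data.List.Relation.Binary.Subset.Propositional using (_⊆_)
open import Data.List.Relation.Unary.Any using (here; there)
import Data.List.Relation.Unary.Any as Any
import Data.List.Relation.Unary.All as All
open import Data.List.Relation.Unary.AllPairs using ([]; _∷_)
open import Data.List.Relation.Unary.Unique.Propositional using (Unique)
import Data.List.Relation.Unary.Unique.Propositional.Properties as Unique
open import Data.List.Relation.Unary.Unique.DecPropositional using (unique?)
open import Data.Vec using (Vec; []; _∷_; zipWith; replicate; toList; tabulate)
import Data.Vec as Vec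
open import Data.Vec.Properties using (∷-injectiveˡ; ∷-injectiveʳ; map-id; length-toList)
open import Data.Product using (Σ; _×_; _,_; proj₁; proj₂; ∃-syntax)
open import Data.Sum using (_⊎_; inj₁; inj₂)
open import Data.Empty using (⊥; ⊥-elim)
open import Function using (case_of_)
open import Relation.Nullary using (¬_; Dec; yes; no)
open import Relation.Nullary.Decidable using (map′; _×-dec_; _→-dec_; from-yes)
open import Relation.Binary.Definitions using (DecidableEquality)
open import Relation.Binary.PropositionalEquality hiding ([_])

pattern ∈₁ = here refl
pattern ∈₂ = there ∈₁
pattern ∈₃ = there ∈₂
pattern ∈₄ = there ∈₃

-- The factors Z2, Z4 and Q8, checked by enumeration

record Enumeration (A : Set) : Set where
  infix 4 _≟_
  field
    elements : List A
    complete : ∀ x → x ∈ elements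
    distinct : Unique elements
    _≟_      : DecidableEquality A

  ∀? : {P : A → Set} → (∀ x → Dec (P x)) → Dec (∀ x → P x)
  ∀? P? = map′ (λ ps x → All.lookup ps (complete x)) (λ p → All.tabulate (λ {x} _ → p x))
               (All.all? P? elements)

record RawGrayGroup : Set₁ where
  infixl 7 _∙_
  field
    Carrier : Set
    _∙_     : Carrier → Carrier → Carrier
    ε υ     : Carrier
    swap    : Carrier → Carrier → Carrier
    weight  : Carrier → ℕ
    width   : ℕ

  square cube : Carrier → Carrier
  square x = x ∙ x
  cube x = x ∙ x ∙ x

  commutator : Carrier → Carrier → Carrier
  commutator x y = x ∙ y ∙ cube x ∙ cube y

  Commute : Carrier → Carrier → Set
  Commute x y = x ∙ y ≡ y ∙ x

-- The laws shared by the factors Z2, Z4 and Q8 of G with their Gray weights: υ is the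
-- factor's entry of u, and inverses are cubes since every factor has exponent dividing 4.
record IsGrayGroup (K : RawGrayGroup) : Set where
  open RawGrayGroup K
  field
    ∙-assoc            : ∀ x y z → x ∙ y ∙ z ≡ x ∙ (y ∙ z)
    ∙-identityˡ        : ∀ x → ε ∙ x ≡ x
    ∙-identityʳ        : ∀ x → x ∙ ε ≡ x
    square-square      : ∀ x → square (square x) ≡ ε
    involution-central : ∀ x y → square x ≡ ε → Commute x y
    ∙-comm-commutator  : ∀ x y → x ∙ y ≡ commutator x y ∙ (y ∙ x)
    commutator-∙ˡ      : ∀ x y z → commutator (x ∙ y) z ≡ commutator x z ∙ commutator y z
    commutator-comm    : ∀ x y → commutator x y ≡ commutator y x
    square-∙           : ∀ x y → square (x ∙ y) ≡ square x ∙ square y ∙ commutator x y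
    square-commutator  : ∀ x y → square (commutator x y) ≡ ε
    square-υ           : square υ ≡ ε
    weight-ε           : weight ε ≡ 0
    weight≡0⇒≡ε        : ∀ x → weight x ≡ 0 → x ≡ ε
    weight-∙υ          : ∀ x → weight (x ∙ υ) + weight x ≡ width
    weight-square-∙    : ∀ x y → Commute x y →
                         weight (square x) + weight (square y) ≡ weight (square (x ∙ y)) + 2 * weight (swap x y)
    swap-comm          : ∀ x y → Commute x y → swap x y ≡ swap y x
    weight-swap-∙ˡ     : ∀ x y z w → Commute x y → Commute x z → Commute x w → Commute y z →
                         Commute y w → Commute z w → swap x y ≡ swap z w →
                         weight (swap (x ∙ z) y) + weight (swap x y) ≡ weight (swap z y)
    centralizer-sqrt-υ : ∀ y x z → square y ≡ υ → Commute y x → Commute y z → Commute x z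

isGrayGroup? : (K : RawGrayGroup) → Enumeration (RawGrayGroup.Carrier K) → Dec (IsGrayGroup K)
isGrayGroup? K E =
  map′ (λ (p₁ , p₂ , p₃ , p₄ , p₅ , p₆ , p₇ , p₈ , p₉ , p₁₀ , p₁₁ , p₁₂ , p₁₃ , p₁₄ , p₁₅ , p₁₆ , p₁₇ , p₁₈)
          → record { ∙-assoc = p₁ ; ∙-identityˡ = p₂ ; ∙-identityʳ = p₃ ; square-square = p₄
                   ; involution-central = p₅ ; ∙-comm-commutator = p₆ ; commutator-∙ˡ = p₇
                   ; commutator-comm = p₈ ; square-∙ = p₉ ; square-commutator = p₁₀ ; square-υ = p₁₁
                   ; weight-ε = p₁₂ ; weight≡0⇒≡ε = p₁₃ ; weight-∙υ = p₁₄ ; weight-square-∙ = p₁₅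
                   ; swap-comm = p₁₆ ; weight-swap-∙ˡ = p₁₇ ; centralizer-sqrt-υ = p₁₈ })
       (λ l → let open IsGrayGroup l in
          ∙-assoc , ∙-identityˡ , ∙-identityʳ , square-square , involution-central , ∙-comm-commutator
          , commutator-∙ˡ , commutator-comm , square-∙ , square-commutator , square-υ , weight-ε , weight≡0⇒≡ε
          , weight-∙υ , weight-square-∙ , swap-comm , weight-swap-∙ˡ , centralizer-sqrt-υ)
       ( (∀? λ x → ∀? λ y → ∀? λ z → x ∙ y ∙ z ≟ x ∙ (y ∙ z))
    ×-dec (∀? λ x → ε ∙ x ≟ x)
    ×-dec (∀? λ x → x ∙ ε ≟ x)
    ×-dec (∀? λ x → square (square x) ≟ ε)
    ×-dec (∀? λ x → ∀? λ y → square x ≟ ε →-dec x ∙ y ≟ y ∙ x)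
    ×-dec (∀? λ x → ∀? λ y → x ∙ y ≟ commutator x y ∙ (y ∙ x))
    ×-dec (∀? λ x → ∀? λ y → ∀? λ z → commutator (x ∙ y) z ≟ commutator x z ∙ commutator y z)
    ×-dec (∀? λ x → ∀? λ y → commutator x y ≟ commutator y x)
    ×-dec (∀? λ x → ∀? λ y → square (x ∙ y) ≟ square x ∙ square y ∙ commutator x y)
    ×-dec (∀? λ x → ∀? λ y → square (commutator x y) ≟ ε)
    ×-dec square υ ≟ ε
    ×-dec weight ε ℕ.≟ 0
    ×-dec (∀? λ x → weight x ℕ.≟ 0 →-dec x ≟ ε)
    ×-dec (∀? λ x → weight (x ∙ υ) + weight x ℕ.≟ width)
    ×-dec (∀? λ x → ∀? λ y → x ∙ y ≟ y ∙ x →-dec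
             weight (square x) + weight (square y) ℕ.≟ weight (square (x ∙ y)) + 2 * weight (swap x y))
    ×-dec (∀? λ x → ∀? λ y → x ∙ y ≟ y ∙ x →-dec swap x y ≟ swap y x)
    ×-dec (∀? λ x → ∀? λ y → ∀? λ z → ∀? λ w →
             x ∙ y ≟ y ∙ x →-dec x ∙ z ≟ z ∙ x →-dec x ∙ w ≟ w ∙ x →-dec y ∙ z ≟ z ∙ y →-dec
             y ∙ w ≟ w ∙ y →-dec z ∙ w ≟ w ∙ z →-dec swap x y ≟ swap z w →-dec
             weight (swap (x ∙ z) y) + weight (swap x y) ℕ.≟ weight (swap z y))
    ×-dec (∀? λ y → ∀? λ x → ∀? λ z →
             square y ≟ υ →-dec y ∙ x ≟ x ∙ y →-dec y ∙ z ≟ z ∙ y →-dec x ∙ z ≟ z ∙ x))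
  where open RawGrayGroup K
        open Enumeration E

ℤ₂ ℤ₄ Q₈ : RawGrayGroup
ℤ₂ = record { Carrier = Bool ; _∙_ = _xor_ ; ε = false ; υ = true ; swap = λ _ _ → false
            ; weight = λ b → ones (b ∷ []) ; width = 1 }
ℤ₄ = record { Carrier = Z4 ; _∙_ = _+₄_ ; ε = z0 ; υ = z2 ; swap = swap4
            ; weight = λ x → ones (gray4 x) ; width = 2 }
Q₈ = record { Carrier = Q8 ; _∙_ = _·₈_ ; ε = 𝟏₈ ; υ = a²₈ ; swap = swap8
            ; weight = λ x → ones (gray8 x) ; width = 4 }

toFin : Z4 → Fin 4
toFin z0 = Fin.zero
toFin z1 = Fin.suc Fin.zero
toFin z2 = Fin.suc (Fin.suc Fin.zero)
toFin z3 = Fin.suc (Fin.suc (Fin.suc Fin.zero))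

fromFin : Fin 4 → Z4
fromFin Fin.zero = z0
fromFin (Fin.suc Fin.zero) = z1
fromFin (Fin.suc (Fin.suc Fin.zero)) = z2
fromFin (Fin.suc (Fin.suc (Fin.suc Fin.zero))) = z3

fromFin∘toFin : ∀ x → fromFin (toFin x) ≡ x
fromFin∘toFin z0 = refl
fromFin∘toFin z1 = refl
fromFin∘toFin z2 = refl
fromFin∘toFin z3 = refl

infix 4 _≟₄_ _≟₈_

_≟₄_ : DecidableEquality Z4
x ≟₄ y = map′ (λ p → trans (sym (fromFin∘toFin x)) (trans (cong fromFin p) (fromFin∘toFin y)))
              (cong toFin) (toFin x Fin.≟ toFin y)

_≟₈_ : DecidableEquality Q8
q i j ≟₈ q k l = map′ (λ (p , r) → cong₂ q p r) (λ { refl → refl , refl }) (i ≟₄ k ×-dec j Bool.≟ l)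

ℤ₂-enumeration : Enumeration Bool
ℤ₂-enumeration = record
  { elements = false ∷ true ∷ []
  ; complete = λ { false → ∈₁ ; true → ∈₂ }
  ; distinct = from-yes (unique? Bool._≟_ (false ∷ true ∷ []))
  ; _≟_ = Bool._≟_ }

ℤ₄-enumeration : Enumeration Z4
ℤ₄-enumeration = record
  { elements = allZ4
  ; complete = λ { z0 → ∈₁ ; z1 → ∈₂ ; z2 → ∈₃ ; z3 → ∈₄ }
  ; distinct = from-yes (unique? _≟₄_ allZ4)
  ; _≟_ = _≟₄_ }

Q₈-enumeration : Enumeration Q8
Q₈-enumeration = record
  { elements = allQ8
  ; complete = λ { (q i false) → ∈-allQ8 i false ; (q i true) → ∈-allQ8 i true }
  ; distinct = from-yes (unique? _≟₈_ allQ8)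
  ; _≟_ = _≟₈_ }
  where
  ∈-allQ8 : ∀ i j → q i j ∈ allQ8
  ∈-allQ8 z0 false = here refl
  ∈-allQ8 z0 true  = there (here refl)
  ∈-allQ8 z1 false = there (there (here refl))
  ∈-allQ8 z1 true  = there (there (there (here refl)))
  ∈-allQ8 z2 false = there (there (there (there (here refl))))
  ∈-allQ8 z2 true  = there (there (there (there (there (here refl)))))
  ∈-allQ8 z3 false = there (there (there (there (there (there (here refl))))))
  ∈-allQ8 z3 true  = there (there (there (there (there (there (there (here refl)))))))

ℤ₂-isGrayGroup : IsGrayGroup ℤ₂
ℤ₂-isGrayGroup = from-yes (isGrayGroup? ℤ₂ ℤ₂-enumeration)

ℤ₄-isGrayGroup : IsGrayGroup ℤ₄
ℤ₄-isGrayGroup = from-yes (isGrayGroup? ℤ₄ ℤ₄-enumeration)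

Q₈-isGrayGroup : IsGrayGroup Q₈
Q₈-isGrayGroup = from-yes (isGrayGroup? Q₈ Q₈-enumeration)

-- Vectors of factors, and G

vec : RawGrayGroup → ℕ → RawGrayGroup
vec K n = record
  { Carrier = Vec Carrier n
  ; _∙_     = zipWith _∙_
  ; ε       = replicate n ε
  ; υ       = replicate n υ
  ; swap    = zipWith swap
  ; weight  = λ x → Vec.sum (Vec.map weight x)
  ; width   = n * width }
  where open RawGrayGroup K

module _ {K : RawGrayGroup} (K-laws : IsGrayGroup K) where
  open IsGrayGroup K-laws
  private module K = RawGrayGroup K

  private
    nil-isGrayGroup : IsGrayGroup (vec K 0)
    nil-isGrayGroup = record
      { ∙-assoc            = λ { [] [] [] → refl }
      ; ∙-identityˡ        = λ { [] → refl }
      ; ∙-identityʳ        = λ { [] → refl }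
      ; square-square      = λ { [] → refl }
      ; involution-central = λ { [] [] _ → refl }
      ; ∙-comm-commutator  = λ { [] [] → refl }
      ; commutator-∙ˡ      = λ { [] [] [] → refl }
      ; commutator-comm    = λ { [] [] → refl }
      ; square-∙           = λ { [] [] → refl }
      ; square-commutator  = λ { [] [] → refl }
      ; square-υ           = refl
      ; weight-ε           = refl
      ; weight≡0⇒≡ε        = λ { [] _ → refl }
      ; weight-∙υ          = λ { [] → refl }
      ; weight-square-∙    = λ { [] [] _ → refl }
      ; swap-comm          = λ { [] [] _ → refl }
      ; weight-swap-∙ˡ     = λ { [] [] [] [] _ _ _ _ _ _ _ → refl }
      ; centralizer-sqrt-υ = λ { [] [] [] _ _ _ → refl } }

    cons-isGrayGroup : ∀ {n} → IsGrayGroup (vec K n) → IsGrayGroup (vec K (suc n))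
    cons-isGrayGroup {n} V-laws = record
      { ∙-assoc            = λ { (a ∷ x) (b ∷ y) (c ∷ z) → cong₂ _∷_ (∙-assoc a b c) (V.∙-assoc x y z) }
      ; ∙-identityˡ        = λ { (a ∷ x) → cong₂ _∷_ (∙-identityˡ a) (V.∙-identityˡ x) }
      ; ∙-identityʳ        = λ { (a ∷ x) → cong₂ _∷_ (∙-identityʳ a) (V.∙-identityʳ x) }
      ; square-square      = λ { (a ∷ x) → cong₂ _∷_ (square-square a) (V.square-square x) }
      ; involution-central = λ { (a ∷ x) (b ∷ y) h →
          cong₂ _∷_ (involution-central a b (∷-injectiveˡ h)) (V.involution-central x y (∷-injectiveʳ h)) }
      ; ∙-comm-commutator  = λ { (a ∷ x) (b ∷ y) → cong₂ _∷_ (∙-comm-commutator a b) (V.∙-comm-commutator x y) }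
      ; commutator-∙ˡ      = λ { (a ∷ x) (b ∷ y) (c ∷ z) → cong₂ _∷_ (commutator-∙ˡ a b c) (V.commutator-∙ˡ x y z) }
      ; commutator-comm    = λ { (a ∷ x) (b ∷ y) → cong₂ _∷_ (commutator-comm a b) (V.commutator-comm x y) }
      ; square-∙           = λ { (a ∷ x) (b ∷ y) → cong₂ _∷_ (square-∙ a b) (V.square-∙ x y) }
      ; square-commutator  = λ { (a ∷ x) (b ∷ y) → cong₂ _∷_ (square-commutator a b) (V.square-commutator x y) }
      ; square-υ           = cong₂ _∷_ square-υ V.square-υ
      ; weight-ε           = cong₂ _+_ weight-ε V.weight-ε
      ; weight≡0⇒≡ε        = λ { (a ∷ x) h → cong₂ _∷_ (weight≡0⇒≡ε a (ℕ.m+n≡0⇒m≡0 (K.weight a) h))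
                                                      (V.weight≡0⇒≡ε x (ℕ.m+n≡0⇒n≡0 (K.weight a) h)) }
      ; weight-∙υ          = λ { (a ∷ x) → trans (interchange (K.weight (a K.∙ K.υ)) _ (K.weight a) _)
                                                 (cong₂ _+_ (weight-∙υ a) (V.weight-∙υ x)) }
      ; weight-square-∙    = λ { (a ∷ x) (b ∷ y) h →
          trans (interchange (K.weight (K.square a)) _ (K.weight (K.square b)) _)
            (trans (cong₂ _+_ (weight-square-∙ a b (∷-injectiveˡ h)) (V.weight-square-∙ x y (∷-injectiveʳ h)))
                   (interchange-double (K.weight (K.square (a K.∙ b))) (K.weight (K.swap a b))
                                       (V.weight (V.square (x V.∙ y))) (V.weight (V.swap x y)))) }
      ; swap-comm          = λ { (a ∷ x) (b ∷ y) h →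
          cong₂ _∷_ (swap-comm a b (∷-injectiveˡ h)) (V.swap-comm x y (∷-injectiveʳ h)) }
      ; weight-swap-∙ˡ     = λ { (a ∷ x) (b ∷ y) (c ∷ z) (d ∷ w) h₁ h₂ h₃ h₄ h₅ h₆ h₇ →
          trans (interchange (K.weight (K.swap (a K.∙ c) b)) _ (K.weight (K.swap a b)) _)
            (cong₂ _+_
              (weight-swap-∙ˡ a b c d (∷-injectiveˡ h₁) (∷-injectiveˡ h₂) (∷-injectiveˡ h₃) (∷-injectiveˡ h₄)
                              (∷-injectiveˡ h₅) (∷-injectiveˡ h₆) (∷-injectiveˡ h₇))
              (V.weight-swap-∙ˡ x y z w (∷-injectiveʳ h₁) (∷-injectiveʳ h₂) (∷-injectiveʳ h₃) (∷-injectiveʳ h₄)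
                                (∷-injectiveʳ h₅) (∷-injectiveʳ h₆) (∷-injectiveʳ h₇))) }
      ; centralizer-sqrt-υ = λ { (a ∷ x) (b ∷ y) (c ∷ z) h₁ h₂ h₃ →
          cong₂ _∷_ (centralizer-sqrt-υ a b c (∷-injectiveˡ h₁) (∷-injectiveˡ h₂) (∷-injectiveˡ h₃))
                    (V.centralizer-sqrt-υ x y z (∷-injectiveʳ h₁) (∷-injectiveʳ h₂) (∷-injectiveʳ h₃)) } }
      where
      module V where
        open RawGrayGroup (vec K n) public
        open IsGrayGroup V-laws public
      interchange : ∀ a b c d → (a + b) + (c + d) ≡ (a + c) + (b + d)
      interchange = solve-∀
      interchange-double : ∀ a b c d → (a + 2 * b) + (c + 2 * d) ≡ (a + c) + 2 * (b + d)
      interchange-double = solve-∀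

  vec-isGrayGroup : ∀ n → IsGrayGroup (vec K n)
  vec-isGrayGroup zero    = nil-isGrayGroup
  vec-isGrayGroup (suc n) = cons-isGrayGroup (vec-isGrayGroup n)

map-cube : (K : RawGrayGroup) (f : RawGrayGroup.Carrier K → RawGrayGroup.Carrier K) →
           (∀ x → f x ≡ RawGrayGroup.cube K x) → ∀ {n} (v : Vec _ n) → Vec.map f v ≡ RawGrayGroup.cube (vec K n) v
map-cube K f f≡cube []      = refl
map-cube K f f≡cube (x ∷ v) = cong₂ _∷_ (f≡cube x) (map-cube K f f≡cube v)

module _ {k1 k2 k3 : ℕ} where

  g-cong : ∀ {a a' b b' c c'} → a ≡ a' → b ≡ b' → c ≡ c' → g {k1} {k2} {k3} a b c ≡ g a' b' c'
  g-cong refl refl refl = refl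

  g-injective : ∀ {a a' b b' c c'} → g {k1} {k2} {k3} a b c ≡ g a' b' c' → a ≡ a' × b ≡ b' × c ≡ c'
  g-injective refl = refl , refl , refl

  GrayG : RawGrayGroup
  GrayG = record
    { Carrier = G k1 k2 k3 ; _∙_ = _·_ ; ε = e ; υ = u ; swap = ⟪_∶_⟫ ; weight = wt
    ; width = k1 + 2 * k2 + 4 * k3 }

  private
    module B = IsGrayGroup (vec-isGrayGroup ℤ₂-isGrayGroup k1)
    module F = IsGrayGroup (vec-isGrayGroup ℤ₄-isGrayGroup k2)
    module Q = IsGrayGroup (vec-isGrayGroup Q₈-isGrayGroup k3)
    module VB = RawGrayGroup (vec ℤ₂ k1)
    module VF = RawGrayGroup (vec ℤ₄ k2)
    module VQ = RawGrayGroup (vec Q₈ k3)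

    ones-++ : ∀ l l' → ones (l ++ l') ≡ ones l + ones l'
    ones-++ []          l' = refl
    ones-++ (true ∷ l)  l' = cong suc (ones-++ l l')
    ones-++ (false ∷ l) l' = ones-++ l l'

    ones-toList : ∀ {n} (a : Vec Bool n) → ones (toList a) ≡ RawGrayGroup.weight (vec ℤ₂ n) a
    ones-toList []          = refl
    ones-toList (true ∷ a)  = cong suc (ones-toList a)
    ones-toList (false ∷ a) = ones-toList a

    ones-concatMap : ∀ {A : Set} (gray : A → List Bool) {n} (v : Vec A n) →
                     ones (concatMap gray (toList v)) ≡ Vec.sum (Vec.map (λ x → ones (gray x)) v)
    ones-concatMap gray []      = refl
    ones-concatMap gray (x ∷ v) = trans (ones-++ (gray x) _) (cong (ones (gray x) +_) (ones-concatMap gray v))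

    wt-g : ∀ a b c → wt (g {k1} {k2} {k3} a b c) ≡ VB.weight a + (VF.weight b + VQ.weight c)
    wt-g a b c = trans (ones-++ (toList a) _)
      (cong₂ _+_ (ones-toList a) (trans (ones-++ (concatMap gray4 (toList b)) _)
                                        (cong₂ _+_ (ones-concatMap gray4 b) (ones-concatMap gray8 c))))

    const-false : ∀ {n} (a a' : Vec Bool n) → zipWith (λ _ _ → false) a a' ≡ replicate n false
    const-false []      []        = refl
    const-false (_ ∷ a) (_ ∷ a') = cong (false ∷_) (const-false a a')

    swap-g : ∀ a b c a' b' c' →
             ⟪ g {k1} {k2} {k3} a b c ∶ g a' b' c' ⟫ ≡ g (VB.swap a a') (VF.swap b b') (VQ.swap c c')
    swap-g a b c a' b' c' = g-cong (sym (const-false a a')) refl refl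

    wt-swap-g : ∀ a b c a' b' c' → wt ⟪ g {k1} {k2} {k3} a b c ∶ g a' b' c' ⟫ ≡
                VB.weight (VB.swap a a') + (VF.weight (VF.swap b b') + VQ.weight (VQ.swap c c'))
    wt-swap-g a b c a' b' c' =
      trans (cong wt (swap-g a b c a' b' c')) (wt-g (VB.swap a a') (VF.swap b b') (VQ.swap c c'))

    interchange₃ : ∀ a₁ a₂ a₃ b₁ b₂ b₃ → (a₁ + (a₂ + a₃)) + (b₁ + (b₂ + b₃)) ≡ (a₁ + b₁) + ((a₂ + b₂) + (a₃ + b₃))
    interchange₃ = solve-∀

    double₃ : ∀ a₁ a₂ a₃ b₁ b₂ b₃ →
              (a₁ + 2 * b₁) + ((a₂ + 2 * b₂) + (a₃ + 2 * b₃)) ≡ (a₁ + (a₂ + a₃)) + 2 * (b₁ + (b₂ + b₃))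
    double₃ = solve-∀

    width-G : ∀ l₁ l₂ l₃ → l₁ * 1 + (l₂ * 2 + l₃ * 4) ≡ l₁ + 2 * l₂ + 4 * l₃
    width-G = solve-∀

    open ≡-Reasoning

    weight-∙u : (x : G k1 k2 k3) → wt (x · u) + wt x ≡ k1 + 2 * k2 + 4 * k3
    weight-∙u (g a b c) = begin
      wt (g a b c · u) + wt (g a b c)
        ≡⟨ cong₂ _+_ (wt-g (a VB.∙ VB.υ) (b VF.∙ VF.υ) (c VQ.∙ VQ.υ)) (wt-g a b c) ⟩
      (VB.weight (a VB.∙ VB.υ) + (VF.weight (b VF.∙ VF.υ) + VQ.weight (c VQ.∙ VQ.υ)))
        + (VB.weight a + (VF.weight b + VQ.weight c))
        ≡⟨ interchange₃ (VB.weight (a VB.∙ VB.υ)) (VF.weight (b VF.∙ VF.υ)) (VQ.weight (c VQ.∙ VQ.υ)) _ _ _ ⟩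
      _ ≡⟨ cong₂ _+_ (B.weight-∙υ a) (cong₂ _+_ (F.weight-∙υ b) (Q.weight-∙υ c)) ⟩
      k1 * 1 + (k2 * 2 + k3 * 4)
        ≡⟨ width-G k1 k2 k3 ⟩
      k1 + 2 * k2 + 4 * k3 ∎

    weight-sq-· : (x y : G k1 k2 k3) → x · y ≡ y · x → wt (sq x) + wt (sq y) ≡ wt (sq (x · y)) + 2 * wt ⟪ x ∶ y ⟫
    weight-sq-· x@(g a b c) y@(g a' b' c') h = let h₁ , h₂ , h₃ = g-injective h in begin
      wt (sq x) + wt (sq y)
        ≡⟨ cong₂ _+_ (wt-g (VB.square a) (VF.square b) (VQ.square c))
                     (wt-g (VB.square a') (VF.square b') (VQ.square c')) ⟩
      _ ≡⟨ interchange₃ (VB.weight (VB.square a)) (VF.weight (VF.square b)) (VQ.weight (VQ.square c))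
                        (VB.weight (VB.square a')) (VF.weight (VF.square b')) (VQ.weight (VQ.square c')) ⟩
      _ ≡⟨ cong₂ _+_ (B.weight-square-∙ a a' h₁) (cong₂ _+_ (F.weight-square-∙ b b' h₂) (Q.weight-square-∙ c c' h₃)) ⟩
      _ ≡⟨ double₃ (VB.weight (VB.square (a VB.∙ a'))) (VF.weight (VF.square (b VF.∙ b')))
                   (VQ.weight (VQ.square (c VQ.∙ c'))) (VB.weight (VB.swap a a'))
                   (VF.weight (VF.swap b b')) (VQ.weight (VQ.swap c c')) ⟩
      _ ≡⟨ sym (cong₂ (λ s t → s + 2 * t) (wt-g (VB.square (a VB.∙ a')) (VF.square (b VF.∙ b')) (VQ.square (c VQ.∙ c')))
                                        (wt-swap-g a b c a' b' c')) ⟩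
      wt (sq (x · y)) + 2 * wt ⟪ x ∶ y ⟫ ∎

    weight-swap-·ˡ : (x y z w : G k1 k2 k3) → x · y ≡ y · x → x · z ≡ z · x → x · w ≡ w · x → y · z ≡ z · y →
                   y · w ≡ w · y → z · w ≡ w · z → ⟪ x ∶ y ⟫ ≡ ⟪ z ∶ w ⟫ →
                   wt ⟪ x · z ∶ y ⟫ + wt ⟪ x ∶ y ⟫ ≡ wt ⟪ z ∶ y ⟫
    weight-swap-·ˡ x@(g a₁ b₁ c₁) y@(g a₂ b₂ c₂) z@(g a₃ b₃ c₃) w@(g a₄ b₄ c₄) h₁ h₂ h₃ h₄ h₅ h₆ h₇ =
      let p₁ , q₁ , r₁ = g-injective h₁ ; p₂ , q₂ , r₂ = g-injective h₂ ; p₃ , q₃ , r₃ = g-injective h₃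
          p₄ , q₄ , r₄ = g-injective h₄ ; p₅ , q₅ , r₅ = g-injective h₅ ; p₆ , q₆ , r₆ = g-injective h₆
          p₇ , q₇ , r₇ = g-injective (trans (sym (swap-g a₁ b₁ c₁ a₂ b₂ c₂)) (trans h₇ (swap-g a₃ b₃ c₃ a₄ b₄ c₄)))
      in begin
      wt ⟪ x · z ∶ y ⟫ + wt ⟪ x ∶ y ⟫
        ≡⟨ cong₂ _+_ (wt-swap-g (a₁ VB.∙ a₃) (b₁ VF.∙ b₃) (c₁ VQ.∙ c₃) a₂ b₂ c₂) (wt-swap-g a₁ b₁ c₁ a₂ b₂ c₂) ⟩
      _ ≡⟨ interchange₃ (VB.weight (VB.swap (a₁ VB.∙ a₃) a₂)) (VF.weight (VF.swap (b₁ VF.∙ b₃) b₂))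
                        (VQ.weight (VQ.swap (c₁ VQ.∙ c₃) c₂)) (VB.weight (VB.swap a₁ a₂))
                        (VF.weight (VF.swap b₁ b₂)) (VQ.weight (VQ.swap c₁ c₂)) ⟩
      _ ≡⟨ cong₂ _+_ (B.weight-swap-∙ˡ a₁ a₂ a₃ a₄ p₁ p₂ p₃ p₄ p₅ p₆ p₇)
             (cong₂ _+_ (F.weight-swap-∙ˡ b₁ b₂ b₃ b₄ q₁ q₂ q₃ q₄ q₅ q₆ q₇)
                        (Q.weight-swap-∙ˡ c₁ c₂ c₃ c₄ r₁ r₂ r₃ r₄ r₅ r₆ r₇)) ⟩
      _ ≡⟨ sym (wt-swap-g a₃ b₃ c₃ a₂ b₂ c₂) ⟩
      wt ⟪ z ∶ y ⟫ ∎

  G-isGrayGroup : IsGrayGroup GrayG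
  G-isGrayGroup = record
    { ∙-assoc            = λ { (g a b c) (g a' b' c') (g a'' b'' c'') →
        g-cong (B.∙-assoc a a' a'') (F.∙-assoc b b' b'') (Q.∙-assoc c c' c'') }
    ; ∙-identityˡ        = λ { (g a b c) → g-cong (B.∙-identityˡ a) (F.∙-identityˡ b) (Q.∙-identityˡ c) }
    ; ∙-identityʳ        = λ { (g a b c) → g-cong (B.∙-identityʳ a) (F.∙-identityʳ b) (Q.∙-identityʳ c) }
    ; square-square      = λ { (g a b c) → g-cong (B.square-square a) (F.square-square b) (Q.square-square c) }
    ; involution-central = λ { (g a b c) (g a' b' c') h → let h₁ , h₂ , h₃ = g-injective h in
        g-cong (B.involution-central a a' h₁) (F.involution-central b b' h₂) (Q.involution-central c c' h₃) }
    ; ∙-comm-commutator  = λ { (g a b c) (g a' b' c') →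
        g-cong (B.∙-comm-commutator a a') (F.∙-comm-commutator b b') (Q.∙-comm-commutator c c') }
    ; commutator-∙ˡ      = λ { (g a b c) (g a' b' c') (g a'' b'' c'') →
        g-cong (B.commutator-∙ˡ a a' a'') (F.commutator-∙ˡ b b' b'') (Q.commutator-∙ˡ c c' c'') }
    ; commutator-comm    = λ { (g a b c) (g a' b' c') →
        g-cong (B.commutator-comm a a') (F.commutator-comm b b') (Q.commutator-comm c c') }
    ; square-∙           = λ { (g a b c) (g a' b' c') → g-cong (B.square-∙ a a') (F.square-∙ b b') (Q.square-∙ c c') }
    ; square-commutator  = λ { (g a b c) (g a' b' c') →
        g-cong (B.square-commutator a a') (F.square-commutator b b') (Q.square-commutator c c') }
    ; square-υ           = g-cong B.square-υ F.square-υ Q.square-υ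
    ; weight-ε           = trans (wt-g VB.ε VF.ε VQ.ε) (cong₂ _+_ B.weight-ε (cong₂ _+_ F.weight-ε Q.weight-ε))
    ; weight≡0⇒≡ε        = λ { (g a b c) h → let h' = trans (sym (wt-g a b c)) h in
        g-cong (B.weight≡0⇒≡ε a (ℕ.m+n≡0⇒m≡0 _ h'))
               (F.weight≡0⇒≡ε b (ℕ.m+n≡0⇒m≡0 _ (ℕ.m+n≡0⇒n≡0 (VB.weight a) h')))
               (Q.weight≡0⇒≡ε c (ℕ.m+n≡0⇒n≡0 _ (ℕ.m+n≡0⇒n≡0 (VB.weight a) h'))) }
    ; weight-∙υ          = weight-∙u
    ; weight-square-∙    = weight-sq-·
    ; swap-comm          = λ { (g a b c) (g a' b' c') h → let _ , h₂ , h₃ = g-injective h in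
        g-cong refl (F.swap-comm b b' h₂) (Q.swap-comm c c' h₃) }
    ; weight-swap-∙ˡ     = weight-swap-·ˡ
    ; centralizer-sqrt-υ = λ { (g a b c) (g a' b' c') (g a'' b'' c'') h₁ h₂ h₃ →
        let p₁ , q₁ , r₁ = g-injective h₁ ; p₂ , q₂ , r₂ = g-injective h₂ ; p₃ , q₃ , r₃ = g-injective h₃ in
        g-cong (B.centralizer-sqrt-υ a a' a'' p₁ p₂ p₃) (F.centralizer-sqrt-υ b b' b'' q₁ q₂ q₃)
               (Q.centralizer-sqrt-υ c c' c'' r₁ r₂ r₃) } }

-- Group identities in G

module _ {k1 k2 k3 : ℕ} where
  open IsGrayGroup (G-isGrayGroup {k1} {k2} {k3}) public
    using (square-square; involution-central; square-υ; weight-ε; weight≡0⇒≡ε; weight-∙υ;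
           weight-square-∙; swap-comm; weight-swap-∙ˡ; centralizer-sqrt-υ)
    renaming (∙-assoc to ·-assoc; ∙-identityˡ to ·-identityˡ; ∙-identityʳ to ·-identityʳ)
  open IsGrayGroup (G-isGrayGroup {k1} {k2} {k3})
    using (∙-comm-commutator; commutator-∙ˡ; commutator-comm; square-∙; square-commutator)
  open RawGrayGroup (GrayG {k1} {k2} {k3}) using (commutator)

  ⁻¹≡cube : (x : G k1 k2 k3) → x ⁻¹ ≡ x · x · x
  ⁻¹≡cube (g a b c) =
    g-cong (trans (sym (map-id a)) (map-cube ℤ₂ (λ b → b) (λ { false → refl ; true → refl }) a))
           (map-cube ℤ₄ neg4 (from-yes (Enumeration.∀? ℤ₄-enumeration λ x → neg4 x ≟₄ (x +₄ x) +₄ x)) b)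
           (map-cube Q₈ inv₈ (from-yes (Enumeration.∀? Q₈-enumeration λ x → inv₈ x ≟₈ (x ·₈ x) ·₈ x)) c)

  [,]≡commutator : (x y : G k1 k2 k3) → [ x , y ] ≡ commutator x y
  [,]≡commutator x y = cong₂ (λ x⁻¹ y⁻¹ → x · y · x⁻¹ · y⁻¹) (⁻¹≡cube x) (⁻¹≡cube y)

  ·-comm-[,] : (x y : G k1 k2 k3) → x · y ≡ [ x , y ] · (y · x)
  ·-comm-[,] x y = trans (∙-comm-commutator x y) (cong (_· (y · x)) (sym ([,]≡commutator x y)))

  [,]-·ˡ : (x y z : G k1 k2 k3) → [ x · y , z ] ≡ [ x , z ] · [ y , z ]
  [,]-·ˡ x y z = trans ([,]≡commutator (x · y) z)
    (trans (commutator-∙ˡ x y z) (sym (cong₂ _·_ ([,]≡commutator x z) ([,]≡commutator y z))))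

  [,]-comm : (x y : G k1 k2 k3) → [ x , y ] ≡ [ y , x ]
  [,]-comm x y = trans ([,]≡commutator x y) (trans (commutator-comm x y) (sym ([,]≡commutator y x)))

  sq-· : (x y : G k1 k2 k3) → sq (x · y) ≡ sq x · sq y · [ x , y ]
  sq-· x y = trans (square-∙ x y) (cong (sq x · sq y ·_) (sym ([,]≡commutator x y)))

  sq-[,] : (x y : G k1 k2 k3) → sq [ x , y ] ≡ e
  sq-[,] x y = trans (cong sq ([,]≡commutator x y)) (square-commutator x y)

module _ {k1 k2 k3 : ℕ} where
  open ≡-Reasoning

  private
    GG = G k1 k2 k3

  sq-central : (x y : GG) → sq x · y ≡ y · sq x
  sq-central x y = involution-central (sq x) y (square-square x)

  ·-inverseˡ : (x : GG) → x ⁻¹ · x ≡ e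
  ·-inverseˡ x = trans (cong (_· x) (⁻¹≡cube x)) (trans (·-assoc (x · x) x x) (square-square x))

  ·-inverseʳ : (x : GG) → x · x ⁻¹ ≡ e
  ·-inverseʳ x = begin
    x · x ⁻¹         ≡⟨ cong (x ·_) (⁻¹≡cube x) ⟩
    x · (x · x · x)  ≡⟨ sym (·-assoc x (x · x) x) ⟩
    x · (x · x) · x  ≡⟨ cong (_· x) (sym (·-assoc x x x)) ⟩
    x · x · x · x    ≡⟨ ·-assoc (x · x) x x ⟩
    sq (sq x)        ≡⟨ square-square x ⟩
    e                ∎

  [,]≡e⇒comm : (x y : GG) → [ x , y ] ≡ e → x · y ≡ y · x
  [,]≡e⇒comm x y h = trans (·-comm-[,] x y) (trans (cong (_· (y · x)) h) (·-identityˡ _))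

  comm⇒[,]≡e : (x y : GG) → x · y ≡ y · x → [ x , y ] ≡ e
  comm⇒[,]≡e x y h = begin
    x · y · x ⁻¹ · y ⁻¹   ≡⟨ cong (λ z → z · x ⁻¹ · y ⁻¹) h ⟩
    y · x · x ⁻¹ · y ⁻¹   ≡⟨ cong (_· y ⁻¹) (·-assoc y x (x ⁻¹)) ⟩
    y · (x · x ⁻¹) · y ⁻¹ ≡⟨ cong (λ z → y · z · y ⁻¹) (·-inverseʳ x) ⟩
    y · e · y ⁻¹          ≡⟨ cong (_· y ⁻¹) (·-identityʳ y) ⟩
    y · y ⁻¹              ≡⟨ ·-inverseʳ y ⟩
    e                     ∎

  [,]-·ʳ : (x y z : GG) → [ x , y · z ] ≡ [ x , y ] · [ x , z ]
  [,]-·ʳ x y z = trans ([,]-comm x (y · z)) (trans ([,]-·ˡ y z x) (cong₂ _·_ ([,]-comm y x) ([,]-comm z x)))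

  [,]-⁻¹ˡ : (x y : GG) → [ x ⁻¹ , y ] ≡ [ x , y ]
  [,]-⁻¹ˡ x y = begin
    [ x ⁻¹ , y ]              ≡⟨ cong [_, y ] (⁻¹≡cube x) ⟩
    [ sq x · x , y ]          ≡⟨ [,]-·ˡ (sq x) x y ⟩
    [ sq x , y ] · [ x , y ]  ≡⟨ cong (_· [ x , y ]) (comm⇒[,]≡e (sq x) y (sq-central x y)) ⟩
    e · [ x , y ]             ≡⟨ ·-identityˡ _ ⟩
    [ x , y ]                 ∎

  [,]-⁻¹ʳ : (x y : GG) → [ x , y ⁻¹ ] ≡ [ x , y ]
  [,]-⁻¹ʳ x y = trans ([,]-comm x (y ⁻¹)) (trans ([,]-⁻¹ˡ y x) ([,]-comm y x))

  [,]-self : (x : GG) → [ x , x ] ≡ e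
  [,]-self x = comm⇒[,]≡e x x refl

  [,]-e : (x : GG) → [ x , e ] ≡ e
  [,]-e x = comm⇒[,]≡e x e (trans (·-identityʳ x) (sym (·-identityˡ x)))

  sq-e : sq (e {k1} {k2} {k3}) ≡ e
  sq-e = ·-identityˡ e

  sq-·-comm : (x y : GG) → [ x , y ] ≡ e → sq (x · y) ≡ sq x · sq y
  sq-·-comm x y h = trans (sq-· x y) (trans (cong (sq x · sq y ·_) h) (·-identityʳ _))

  sq-⁻¹ : (x : GG) → sq (x ⁻¹) ≡ sq x
  sq-⁻¹ x = begin
    sq (x ⁻¹)              ≡⟨ cong sq (⁻¹≡cube x) ⟩
    sq (sq x · x)          ≡⟨ sq-·-comm (sq x) x (comm⇒[,]≡e (sq x) x (sq-central x x)) ⟩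
    sq (sq x) · sq x       ≡⟨ cong (_· sq x) (square-square x) ⟩
    e · sq x               ≡⟨ ·-identityˡ _ ⟩
    sq x                   ∎

  sq-·⁻¹ : (x y : GG) → x · y ≡ y · x → sq (y · x ⁻¹) ≡ sq (x · y)
  sq-·⁻¹ x y xy≡yx = begin
    sq (y · x ⁻¹)    ≡⟨ sq-·-comm y (x ⁻¹) (trans ([,]-⁻¹ʳ y x) (comm⇒[,]≡e y x (sym xy≡yx))) ⟩
    sq y · sq (x ⁻¹) ≡⟨ cong (sq y ·_) (sq-⁻¹ x) ⟩
    sq y · sq x      ≡⟨ sym (sq-central x (sq y)) ⟩
    sq x · sq y      ≡⟨ sym (sq-·-comm x y (comm⇒[,]≡e x y xy≡yx)) ⟩
    sq (x · y)       ∎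

∧-elim : ∀ {a b} → a ∧ b ≡ true → a ≡ true × b ≡ true
∧-elim {true} h = refl , h

⇔⇒≡ : ∀ {a b} → (a ≡ true → b ≡ true) → (b ≡ true → a ≡ true) → a ≡ b
⇔⇒≡ {false} {false} _ _ = refl
⇔⇒≡ {false} {true}  _ b⇒a = b⇒a refl
⇔⇒≡ {true}  {false} a⇒b _ = sym (a⇒b refl)
⇔⇒≡ {true}  {true}  _ _ = refl

⇒-elim : ∀ {a b} → not a ∨ b ≡ true → a ≡ true → b ≡ true
⇒-elim h refl = h

⇒-intro : ∀ {a b} → (a ≡ true → b ≡ true) → not a ∨ b ≡ true
⇒-intro {false} f = refl
⇒-intro {true}  f = f refl

module _ {A : Set} (p : A → Bool) where

  allL-elim : ∀ {xs x} → allL p xs ≡ true → x ∈ xs → p x ≡ true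
  allL-elim {x ∷ _} h (here refl) = proj₁ (∧-elim h)
  allL-elim {_ ∷ _} h (there x∈) = allL-elim (proj₂ (∧-elim {p _} h)) x∈

  allL-intro : ∀ xs → (∀ x → p x ≡ true) → allL p xs ≡ true
  allL-intro []       f = refl
  allL-intro (x ∷ xs) f rewrite f x = allL-intro xs f

module _ {k1 k2 k3 : ℕ} (P : SubsetG {k1} {k2} {k3}) {x : G k1 k2 k3} where

  ¬∈⇒∉ : ¬ (x ∈G P) → x ∉G P
  ¬∈⇒∉ x∉P with P x
  ... | false = refl
  ... | true  = ⊥-elim (x∉P refl)

  ∉⇒¬∈ : x ∉G P → ¬ (x ∈G P)
  ∉⇒¬∈ x∉P x∈P with () ← trans (sym x∉P) x∈P

module _ {A : Set} {eq : A → A → Bool} (eq-sound : ∀ x y → eq x y ≡ true → x ≡ y) where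

  eqVec-sound : ∀ {n} (v w : Vec A n) → eqVec eq v w ≡ true → v ≡ w
  eqVec-sound []      []      h = refl
  eqVec-sound (x ∷ v) (y ∷ w) h = let hx , hv = ∧-elim h in cong₂ _∷_ (eq-sound x y hx) (eqVec-sound v w hv)

eqVec-refl : ∀ {A : Set} {eq : A → A → Bool} → (∀ x → eq x x ≡ true) → ∀ {n} (v : Vec A n) → eqVec eq v v ≡ true
eqVec-refl eq-refl []      = refl
eqVec-refl eq-refl (x ∷ v) rewrite eq-refl x = eqVec-refl eq-refl v

∈-concatMap : ∀ {A B : Set} (f : A → List B) {x xs y} → x ∈ xs → y ∈ f x → y ∈ concatMap f xs
∈-concatMap f x∈ y∈ = ∈-concatMap⁺ f (Any.map (λ { refl → y∈ }) x∈)

allVec-complete : ∀ {A : Set} {xs : List A} → (∀ x → x ∈ xs) → ∀ {n} (v : Vec A n) → v ∈ allVec xs n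
allVec-complete complete []      = here refl
allVec-complete complete (x ∷ v) = ∈-concatMap _ (complete x) (∈-map⁺ (x ∷_) (allVec-complete complete v))

module _ {k1 k2 k3 : ℕ} where

  private
    GG = G k1 k2 k3
    open Enumeration using (complete)

  ==⇒≡ : (x y : GG) → (x == y) ≡ true → x ≡ y
  ==⇒≡ (g a b c) (g a' b' c') h =
    let ha , hbc = ∧-elim h ; hb , hc = ∧-elim {eqVec eq4 b b'} hbc in
    g-cong (eqVec-sound (from-yes (∀₂ ℤ₂-enumeration λ s t → (if s then t else not t) Bool.≟ true →-dec s Bool.≟ t))
                        a a' ha)
           (eqVec-sound (from-yes (∀₂ ℤ₄-enumeration λ s t → eq4 s t Bool.≟ true →-dec s ≟₄ t)) b b' hb)
           (eqVec-sound (from-yes (∀₂ Q₈-enumeration λ s t → eq8 s t Bool.≟ true →-dec s ≟₈ t)) c c' hc)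
    where
    ∀₂ : ∀ {A : Set} (E : Enumeration A) {P : A → A → Set} → (∀ s t → Dec (P s t)) → Dec (∀ s t → P s t)
    ∀₂ E P? = Enumeration.∀? E λ s → Enumeration.∀? E (P? s)

  ==-refl : (x : GG) → (x == x) ≡ true
  ==-refl (g a b c) =
    cong₂ _∧_ (eqVec-refl (λ { false → refl ; true → refl }) a)
              (cong₂ _∧_ (eqVec-refl (from-yes (Enumeration.∀? ℤ₄-enumeration λ s → eq4 s s Bool.≟ true)) b)
                         (eqVec-refl (from-yes (Enumeration.∀? Q₈-enumeration λ s → eq8 s s Bool.≟ true)) c))

  _≟G_ : DecidableEquality GG
  x ≟G y = map′ (==⇒≡ x y) (λ { refl → ==-refl x }) ((x == y) Bool.≟ true)

  ∈-allG : (x : GG) → x ∈ allG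
  ∈-allG (g a b c) =
    ∈-concatMap _ (allVec-complete (complete ℤ₂-enumeration) a)
      (∈-concatMap _ (allVec-complete (complete ℤ₄-enumeration) b)
        (∈-map⁺ (g a b) (allVec-complete (complete Q₈-enumeration) c)))

-- Subgroups generated by lists

module _ {k1 k2 k3 : ℕ} where

  private
    GG = G k1 k2 k3

  PairwiseCommuting : List GG → Set
  PairwiseCommuting S = ∀ {s s'} → s ∈ S → s' ∈ S → [ s , s' ] ≡ e

  ⟨⟩-generator : ∀ {S : List GG} {s} → s ∈ S → ⟨ S ⟩ s
  ⟨⟩-generator {s = s} s∈ = subst ⟨ _ ⟩ (·-identityʳ s) (gen-mul s∈ gen-e)

  ⟨⟩-· : ∀ {S : List GG} {x y} → ⟨ S ⟩ x → ⟨ S ⟩ y → ⟨ S ⟩ (x · y)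
  ⟨⟩-· {y = y} gen-e                   y∈ = subst ⟨ _ ⟩ (sym (·-identityˡ y)) y∈
  ⟨⟩-· {y = y} (gen-mul {s} {x} s∈ x∈) y∈ = subst ⟨ _ ⟩ (sym (·-assoc s x y)) (gen-mul s∈ (⟨⟩-· x∈ y∈))
  ⟨⟩-· {y = y} (gen-inv {s} {x} s∈ x∈) y∈ = subst ⟨ _ ⟩ (sym (·-assoc (s ⁻¹) x y)) (gen-inv s∈ (⟨⟩-· x∈ y∈))

  ⟨⟩-mono : ∀ {S S' : List GG} → S ⊆ S' → ∀ {x} → ⟨ S ⟩ x → ⟨ S' ⟩ x
  ⟨⟩-mono S⊆S' gen-e          = gen-e
  ⟨⟩-mono S⊆S' (gen-mul s∈ x∈) = gen-mul (S⊆S' s∈) (⟨⟩-mono S⊆S' x∈)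
  ⟨⟩-mono S⊆S' (gen-inv s∈ x∈) = gen-inv (S⊆S' s∈) (⟨⟩-mono S⊆S' x∈)

  ⟨⟩-centralized : ∀ {S : List GG} h → (∀ {s} → s ∈ S → [ h , s ] ≡ e) → ∀ {x} → ⟨ S ⟩ x → [ h , x ] ≡ e
  ⟨⟩-centralized h hS gen-e = [,]-e h
  ⟨⟩-centralized h hS (gen-mul {s} {x} s∈ x∈) =
    trans ([,]-·ʳ h s x) (trans (cong₂ _·_ (hS s∈) (⟨⟩-centralized h hS x∈)) sq-e)
  ⟨⟩-centralized h hS (gen-inv {s} {x} s∈ x∈) =
    trans ([,]-·ʳ h (s ⁻¹) x) (trans (cong₂ _·_ (trans ([,]-⁻¹ʳ h s) (hS s∈)) (⟨⟩-centralized h hS x∈)) sq-e)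

  ⟨⟩-abelian : ∀ {S : List GG} → PairwiseCommuting S → ∀ {x y} → ⟨ S ⟩ x → ⟨ S ⟩ y → [ x , y ] ≡ e
  ⟨⟩-abelian S-comm {x} x∈ =
    ⟨⟩-centralized x (λ {s} s∈ → trans ([,]-comm x s) (⟨⟩-centralized s (S-comm s∈) x∈))

  sq-⟨⟩ : ∀ {S S' : List GG} → PairwiseCommuting S → (∀ {s} → s ∈ S → ⟨ S' ⟩ (sq s)) → ∀ {x} → ⟨ S ⟩ x → ⟨ S' ⟩ (sq x)
  sq-⟨⟩ S-comm sqS gen-e = subst ⟨ _ ⟩ (sym sq-e) gen-e
  sq-⟨⟩ S-comm sqS (gen-mul {s} {x} s∈ x∈) =
    subst ⟨ _ ⟩ (sym (sq-·-comm s x (⟨⟩-centralized s (S-comm s∈) x∈))) (⟨⟩-· (sqS s∈) (sq-⟨⟩ S-comm sqS x∈))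
  sq-⟨⟩ S-comm sqS (gen-inv {s} {x} s∈ x∈) =
    subst ⟨ _ ⟩ (sym (trans (sq-·-comm (s ⁻¹) x (trans ([,]-⁻¹ˡ s x) (⟨⟩-centralized s (S-comm s∈) x∈)))
                            (cong (_· sq x) (sq-⁻¹ s))))
          (⟨⟩-· (sqS s∈) (sq-⟨⟩ S-comm sqS x∈))

module Subgroup {k1 k2 k3 : ℕ} (C : SubsetG {k1} {k2} {k3}) (C-subgroup : IsSubgroup C) where

  private
    GG = G k1 k2 k3

  e∈C : e ∈G C
  e∈C = proj₁ C-subgroup

  ·∈C : ∀ {x y} → x ∈G C → y ∈G C → (x · y) ∈G C
  ·∈C = proj₁ (proj₂ C-subgroup) _ _

  ⁻¹∈C : ∀ {x} → x ∈G C → (x ⁻¹) ∈G C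
  ⁻¹∈C = proj₂ (proj₂ C-subgroup) _

  sq∈C : ∀ {x} → x ∈G C → sq x ∈G C
  sq∈C x∈ = ·∈C x∈ x∈

  [,]∈C : ∀ {x y} → x ∈G C → y ∈G C → [ x , y ] ∈G C
  [,]∈C x∈ y∈ = ·∈C (·∈C (·∈C x∈ y∈) (⁻¹∈C x∈)) (⁻¹∈C y∈)

  ⟨⟩⊆C : ∀ {S : List GG} → (∀ {s} → s ∈ S → s ∈G C) → ∀ {x} → ⟨ S ⟩ x → x ∈G C
  ⟨⟩⊆C S⊆C gen-e           = e∈C
  ⟨⟩⊆C S⊆C (gen-mul s∈ x∈) = ·∈C (S⊆C s∈) (⟨⟩⊆C S⊆C x∈)
  ⟨⟩⊆C S⊆C (gen-inv s∈ x∈) = ·∈C (⁻¹∈C (S⊆C s∈)) (⟨⟩⊆C S⊆C x∈)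

  ∈T⇒∈C : ∀ {x} → x ∈G Tor C → x ∈G C
  ∈T⇒∈C x∈T = proj₁ (∧-elim x∈T)

  ∈T⇒sq≡e : ∀ {x} → x ∈G Tor C → sq x ≡ e
  ∈T⇒sq≡e {x} x∈T = ==⇒≡ (sq x) e (proj₂ (∧-elim {C x} x∈T))

  ∈T-intro : ∀ {x} → x ∈G C → sq x ≡ e → x ∈G Tor C
  ∈T-intro {x} x∈C sq≡e rewrite x∈C = subst (λ (y : GG) → (y == e) ≡ true) (sym sq≡e) (==-refl (e {k1} {k2} {k3}))

  ∉T⇒sq≢e : ∀ {x} → x ∈G C → x ∉G Tor C → sq x ≢ e
  ∉T⇒sq≢e x∈C x∉T sq≡e with () ← trans (sym x∉T) (∈T-intro x∈C sq≡e)

  ∈T⇒central : ∀ {t} → t ∈G Tor C → ∀ x → [ t , x ] ≡ e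
  ∈T⇒central {t} t∈T x = comm⇒[,]≡e t x (involution-central t x (∈T⇒sq≡e t∈T))

  e∈T : e ∈G Tor C
  e∈T = ∈T-intro e∈C sq-e

  ·∈T : ∀ {x y} → x ∈G Tor C → y ∈G Tor C → (x · y) ∈G Tor C
  ·∈T {x} {y} x∈T y∈T = ∈T-intro (·∈C (∈T⇒∈C x∈T) (∈T⇒∈C y∈T)) (begin
    sq (x · y)          ≡⟨ sq-·-comm x y (∈T⇒central x∈T y) ⟩
    sq x · sq y         ≡⟨ cong₂ _·_ (∈T⇒sq≡e x∈T) (∈T⇒sq≡e y∈T) ⟩
    e · e               ≡⟨ sq-e ⟩
    e                   ∎)
    where open ≡-Reasoning

  sq∈T : ∀ {x} → x ∈G C → sq x ∈G Tor C
  sq∈T x∈C = ∈T-intro (sq∈C x∈C) (square-square _)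

  [,]∈T : ∀ {x y} → x ∈G C → y ∈G C → [ x , y ] ∈G Tor C
  [,]∈T x∈C y∈C = ∈T-intro ([,]∈C x∈C y∈C) (sq-[,] _ _)

  ∈Z⇒∈C : ∀ {z} → z ∈G Cen C → z ∈G C
  ∈Z⇒∈C z∈Z = proj₁ (∧-elim z∈Z)

  ∈Z⇒comm : ∀ {z x} → z ∈G Cen C → x ∈G C → z · x ≡ x · z
  ∈Z⇒comm {z} {x} z∈Z x∈C =
    ==⇒≡ _ _ (⇒-elim (allL-elim (λ y → not (C y) ∨ (z · y == y · z)) (proj₂ (∧-elim {C z} z∈Z)) (∈-allG x)) x∈C)

  ∈Z-intro : ∀ {z} → z ∈G C → (∀ x → x ∈G C → z · x ≡ x · z) → z ∈G Cen C
  ∈Z-intro {z} z∈C comm rewrite z∈C =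
    allL-intro _ allG λ x → ⇒-intro λ x∈C → subst (λ y → (z · x == y) ≡ true) (comm x x∈C) (==-refl (z · x))

-- Weights in a binary Hadamard code

module HadamardCode where
  open import Data.Integer using (ℤ; +_; -[1+_]) renaming (_+_ to _+ℤ_; _*_ to _*ℤ_)
  import Data.Integer.Properties as ℤ
  open import Data.Integer.Tactic.RingSolver using () renaming (solve-∀ to ℤ-solve-∀)

  sumFin-cong : ∀ n {f f' : Fin n → ℤ} → (∀ k → f k ≡ f' k) → sumFin n f ≡ sumFin n f'
  sumFin-cong zero    f≗f' = refl
  sumFin-cong (suc n) f≗f' = cong₂ _+ℤ_ (f≗f' Fin.zero) (sumFin-cong n (λ k → f≗f' (Fin.suc k)))

  bits : ∀ {n} → (Fin n → ℤ) → List Bool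
  bits f = toList (tabulate (λ k → toBit (f k)))

  sum±1 : ∀ n (f : Fin n → ℤ) → (∀ k → f k ≡ + 1 ⊎ f k ≡ -[1+ 0 ]) →
          sumFin n f +ℤ + (2 * ones (bits f)) ≡ + n
  sum±1 zero    f ±1 = refl
  sum±1 (suc n) f ±1 with f Fin.zero | ±1 Fin.zero | sum±1 n (λ k → f (Fin.suc k)) (λ k → ±1 (Fin.suc k))
  ... | _ | inj₁ refl | ih = trans (ℤ.+-assoc (+ 1) (sumFin n (λ k → f (Fin.suc k))) _) (cong (_+ℤ_ (+ 1)) ih)
  ... | _ | inj₂ refl | ih = begin
      (-[1+ 0 ] +ℤ S) +ℤ + (2 * suc w)       ≡⟨ cong (λ m → (-[1+ 0 ] +ℤ S) +ℤ + m) (ℕ.*-suc 2 w) ⟩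
      (-[1+ 0 ] +ℤ S) +ℤ (+ 2 +ℤ + (2 * w)) ≡⟨ rearrange S (+ (2 * w)) ⟩
      + 1 +ℤ (S +ℤ + (2 * w))                ≡⟨ cong (_+ℤ_ (+ 1)) ih ⟩
      + suc n                                ∎
    where
    open ≡-Reasoning
    S = sumFin n (λ k → f (Fin.suc k))
    w = ones (bits (λ k → f (Fin.suc k)))
    rearrange : ∀ S P → (-[1+ 0 ] +ℤ S) +ℤ (+ 2 +ℤ P) ≡ + 1 +ℤ (S +ℤ P)
    rearrange = ℤ-solve-∀

  ones-false : ∀ n (f : Fin n → Bool) → (∀ k → f k ≡ false) → ones (toList (tabulate f)) ≡ 0
  ones-false zero    f f≡false = refl
  ones-false (suc n) f f≡false rewrite f≡false Fin.zero = ones-false n (λ k → f (Fin.suc k)) (λ k → f≡false (Fin.suc k))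

  ones-map-not : ∀ v → ones (map not v) + ones v ≡ length v
  ones-map-not []          = refl
  ones-map-not (true ∷ v)  = trans (ℕ.+-suc _ _) (cong suc (ones-map-not v))
  ones-map-not (false ∷ v) = cong suc (ones-map-not v)

  -- The first row is constant; every other row is orthogonal to it, so it is balanced.
  row-weight : ∀ n (H : Fin n → Fin n → ℤ) → IsNormHadamard n H → ∀ i →
               ones (row H i) ≡ 0 ⊎ 2 * ones (row H i) ≡ n
  row-weight (suc n) H (_ , _ , _ , normalized) Fin.zero =
    inj₁ (ones-false (suc n) _ (λ k → cong toBit (normalized Fin.zero k (inj₁ refl))))
  row-weight (suc n) H (±1 , _ , orthogonal , normalized) (Fin.suc i) = inj₂ (ℤ.+-injective (begin
    + (2 * w)                                 ≡⟨ sym (ℤ.+-identityˡ _) ⟩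
    + 0 +ℤ + (2 * w)                          ≡⟨ cong (_+ℤ + (2 * w)) (sym row-sum) ⟩
    sumFin (suc n) (H (Fin.suc i)) +ℤ + (2 * w) ≡⟨ sum±1 (suc n) (H (Fin.suc i)) (±1 (Fin.suc i)) ⟩
    + suc n                                   ∎))
    where
    open ≡-Reasoning
    w = ones (row H (Fin.suc i))
    row-sum : sumFin (suc n) (H (Fin.suc i)) ≡ + 0
    row-sum = trans (sumFin-cong (suc n) λ k → trans (sym (ℤ.*-identityʳ (H (Fin.suc i) k)))
                                                      (cong (H (Fin.suc i) k *ℤ_) (sym (normalized Fin.zero k (inj₁ refl)))))
                    (orthogonal (Fin.suc i) Fin.zero (λ ()))

  codeword-weight : ∀ n {S : List Bool → Set} → IsHadamardCode n S → ∀ {v} → S v →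
                    ones v ≡ 0 ⊎ ones v ≡ n ⊎ 2 * ones v ≡ n
  codeword-weight n (H , H-hadamard , S⊆rows , _) v∈S with S⊆rows _ v∈S
  ... | i , inj₁ refl with row-weight n H H-hadamard i
  ...   | inj₁ w≡0  = inj₁ w≡0
  ...   | inj₂ 2w≡n = inj₂ (inj₂ 2w≡n)
  codeword-weight n (H , H-hadamard , S⊆rows , _) v∈S | i , inj₂ refl with row-weight n H H-hadamard i
  ...   | inj₁ w≡0  = inj₂ (inj₁ (begin
          ones (map not (row H i))                 ≡⟨ sym (ℕ.+-identityʳ _) ⟩
          ones (map not (row H i)) + 0             ≡⟨ cong (_+_ (ones (map not (row H i)))) (sym w≡0) ⟩
          ones (map not (row H i)) + ones (row H i) ≡⟨ ones-map-not (row H i) ⟩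
          length (row H i)                         ≡⟨ length-toList (tabulate _) ⟩
          n                                        ∎))
    where open ≡-Reasoning
  ...   | inj₂ 2w≡n = inj₂ (inj₂ (trans (cong (2 *_) complement≡) 2w≡n))
    where
    w = ones (row H i)
    complement≡ : ones (map not (row H i)) ≡ w
    complement≡ = ℕ.+-cancelʳ-≡ _ _ w (begin
      ones (map not (row H i)) + w ≡⟨ ones-map-not (row H i) ⟩
      length (row H i)            ≡⟨ length-toList (tabulate _) ⟩
      n                           ≡⟨ sym 2w≡n ⟩
      2 * w                       ≡⟨ cong (_+_ w) (ℕ.+-identityʳ w) ⟩
      w + w                       ∎)
      where open ≡-Reasoning

open HadamardCode using (codeword-weight)

-- Counting T(C)-cosets

module _ {A : Set} (p : A → Bool) where

  countL≤length : ∀ D L → Unique D → (∀ {x} → x ∈ D → p x ≡ true → x ∈ L) → countL p D ≤ length L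
  countL≤length []      L _              covers = z≤n
  countL≤length (x ∷ D) L (x∉D ∷ D-uniq) covers with p x in px
  ... | false = countL≤length D L D-uniq (λ x∈ → covers (there x∈))
  ... | true with ∈-∃++ (covers (here refl) px)
  ...   | L₁ , L₂ , refl = subst (suc (countL p D) ≤_) (sym (List.length-++-sucʳ L₁ x L₂))
    (s≤s (countL≤length D (L₁ ++ L₂) D-uniq λ {y} y∈D py → remove y (covers (there y∈D) py)
                                                                   (λ { refl → All.lookup x∉D y∈D refl })))
    where
    remove : ∀ y {L₁ L₂} → y ∈ L₁ ++ x ∷ L₂ → y ≢ x → y ∈ L₁ ++ L₂
    remove y {[]}     (here refl) y≢x = ⊥-elim (y≢x refl)
    remove y {[]}     (there y∈)  y≢x = y∈
    remove y {_ ∷ _}  (here refl) y≢x = here refl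
    remove y {_ ∷ L₁} (there y∈)  y≢x = there (remove y {L₁} y∈ y≢x)

  length-filterᵇ : ∀ xs → length (filterᵇ p xs) ≡ countL p xs
  length-filterᵇ []       = refl
  length-filterᵇ (x ∷ xs) with p x
  ... | true  = cong suc (length-filterᵇ xs)
  ... | false = length-filterᵇ xs

  countL-pos : ∀ {x xs} → x ∈ xs → p x ≡ true → 1 ≤ countL p xs
  countL-pos {xs = y ∷ _} (here refl) px rewrite px = s≤s z≤n
  countL-pos {xs = y ∷ _} (there x∈)  px with p y
  ... | true  = s≤s z≤n
  ... | false = countL-pos x∈ px

countL-cong : ∀ {A : Set} {p p' : A → Bool} → (∀ x → p x ≡ p' x) → ∀ xs → countL p xs ≡ countL p' xs
countL-cong p≗p' []       = refl
countL-cong {p' = p'} p≗p' (x ∷ xs) rewrite p≗p' x with p' x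
... | true  = cong suc (countL-cong p≗p' xs)
... | false = countL-cong p≗p' xs

length-concatMap : ∀ {A B : Set} (f : A → List B) {n} → (∀ x → length (f x) ≡ n) → ∀ xs →
                   length (concatMap f xs) ≡ length xs * n
length-concatMap f f-length []       = refl
length-concatMap f f-length (x ∷ xs) =
  trans (List.length-++ (f x)) (cong₂ _+_ (f-length x) (length-concatMap f f-length xs))

length-allVec : ∀ {A : Set} (xs : List A) k → length (allVec xs k) ≡ length xs ^ k
length-allVec xs zero    = refl
length-allVec xs (suc k) =
  trans (length-concatMap _ (λ x → List.length-map (x ∷_) (allVec xs k)) xs) (cong (length xs *_) (length-allVec xs k))

Unique-concatMap : ∀ {A B : Set} (f : A → List B) {xs} → Unique xs → (∀ x → Unique (f x)) →
                   (∀ {x x' y} → y ∈ f x → y ∈ f x' → x ≡ x') → Unique (concatMap f xs)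
Unique-concatMap f {[]}     _                _      _         = []
Unique-concatMap f {x ∷ xs} (x∉xs ∷ xs-uniq) f-uniq separated =
  Unique.++⁺ (f-uniq x) (Unique-concatMap f xs-uniq f-uniq separated) λ (y∈fx , y∈rest) →
    All.lookupWith {R = λ _ → ⊥} (λ x≢x' y∈fx' → x≢x' (separated y∈fx y∈fx')) x∉xs (∈-concatMap⁻ f y∈rest)

Unique-allVec : ∀ {A : Set} {xs : List A} → Unique xs → ∀ k → Unique (allVec xs k)
Unique-allVec xs-uniq zero    = All.[] ∷ []
Unique-allVec {xs = xs} xs-uniq (suc k) =
  Unique-concatMap _ xs-uniq (λ x → Unique.map⁺ ∷-injectiveʳ (Unique-allVec xs-uniq k)) head≡
  where
  head≡ : ∀ {x x' v} → v ∈ map (x ∷_) (allVec xs k) → v ∈ map (x' ∷_) (allVec xs k) → x ≡ x'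
  head≡ v∈ v∈' with ∈-map⁻ _ v∈ | ∈-map⁻ _ v∈'
  ... | _ , _ , refl | _ , _ , eq = ∷-injectiveˡ eq

index-bound-contradiction : ∀ {X T} k → 1 ≤ T → X ≡ 2 ^ suc k * T → X ≤ 2 ^ k * T → ⊥
index-bound-contradiction {X} {T} k T≥1 X≡ X≤ = ℕ.<-irrefl refl (begin-strict
  2 ^ k * T             <⟨ ℕ.m<m+n (2 ^ k * T) (ℕ.*-mono-≤ (ℕ.m^n>0 2 k) T≥1) ⟩
  2 ^ k * T + 2 ^ k * T ≡⟨ cong (2 ^ k * T +_) (sym (ℕ.+-identityʳ _)) ⟩
  2 * (2 ^ k * T)       ≡⟨ sym (ℕ.*-assoc 2 (2 ^ k) T) ⟩
  2 ^ suc k * T         ≡⟨ sym X≡ ⟩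
  X                     ≤⟨ X≤ ⟩
  2 ^ k * T             ∎)
  where open ℕ.≤-Reasoning

module _ {k1 k2 k3 : ℕ} where

  private
    GG = G k1 k2 k3
    open Enumeration using (distinct)

  Unique-allG : Unique (allG {k1} {k2} {k3})
  Unique-allG =
    Unique-concatMap _ (Unique-allVec (distinct ℤ₂-enumeration) k1)
      (λ a → Unique-concatMap _ (Unique-allVec (distinct ℤ₄-enumeration) k2)
               (λ b → Unique.map⁺ (λ eq → proj₂ (proj₂ (g-injective eq))) (Unique-allVec (distinct Q₈-enumeration) k3))
               c4≡)
      c2≡
    where
    c4≡ : ∀ {a b b' x} → x ∈ map (g a b) (allVec allQ8 k3) → x ∈ map (g a b') (allVec allQ8 k3) → b ≡ b'
    c4≡ x∈ x∈' with ∈-map⁻ _ x∈ | ∈-map⁻ _ x∈'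
    ... | _ , _ , refl | _ , _ , eq = proj₁ (proj₂ (g-injective eq))
    c2≡ : ∀ {a a' x} → x ∈ concatMap (λ b → map (g a b) (allVec allQ8 k3)) (allVec allZ4 k2) →
                       x ∈ concatMap (λ b → map (g a' b) (allVec allQ8 k3)) (allVec allZ4 k2) → a ≡ a'
    c2≡ {a} {a'} x∈ x∈' with Any.satisfied (∈-concatMap⁻ _ {xs = allVec allZ4 k2} x∈)
                           | Any.satisfied (∈-concatMap⁻ _ {xs = allVec allZ4 k2} x∈')
    ... | _ , y∈ | _ , y∈' with ∈-map⁻ _ y∈ | ∈-map⁻ _ y∈'
    ...   | _ , _ , refl | _ , _ , eq = proj₁ (g-injective eq)

  module Span (C : SubsetG {k1} {k2} {k3}) (C-subgroup : IsSubgroup C) where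
    open Subgroup C C-subgroup
    open ≡-Reasoning

    product : (hs : List GG) → Vec Bool (length hs) → GG
    product []       []      = e
    product (h ∷ hs) (b ∷ ε) = (if b then h else e) · product hs ε

    -- Multiplying a subproduct by one of its factors changes it only up to T(C):
    -- squares and commutators of elements of C lie in T(C).
    factor·product : ∀ {hs h} → (∀ {h'} → h' ∈ hs → h' ∈G C) → h ∈ hs → ∀ ε →
                     Σ (Vec Bool (length hs)) λ ε' → Σ GG λ t → t ∈G Tor C × h · product hs ε ≡ t · product hs ε'
    factor·product {h₀ ∷ hs} hs⊆C ∈₁ (true ∷ ε) =
      false ∷ ε , sq h₀ , sq∈T (hs⊆C ∈₁) , trans (sym (·-assoc h₀ h₀ _)) (cong (sq h₀ ·_) (sym (·-identityˡ _)))
    factor·product {h₀ ∷ hs} hs⊆C ∈₁ (false ∷ ε) =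
      true ∷ ε , e , e∈T , trans (cong (h₀ ·_) (·-identityˡ _)) (sym (·-identityˡ _))
    factor·product {h₀ ∷ hs} {h} hs⊆C (there h∈) (b ∷ ε)
      with ε' , t , t∈T , h·p≡ ← factor·product (λ h'∈ → hs⊆C (there h'∈)) h∈ ε =
      b ∷ ε' , [ h , a ] · t , ·∈T ([,]∈T (hs⊆C (there h∈)) a∈C) t∈T , (begin
        h · (a · p)                ≡⟨ sym (·-assoc h a p) ⟩
        h · a · p                  ≡⟨ cong (_· p) (·-comm-[,] h a) ⟩
        [ h , a ] · (a · h) · p    ≡⟨ ·-assoc [ h , a ] (a · h) p ⟩
        [ h , a ] · (a · h · p)    ≡⟨ cong ([ h , a ] ·_) (·-assoc a h p) ⟩
        [ h , a ] · (a · (h · p))  ≡⟨ cong (λ z → [ h , a ] · (a · z)) h·p≡ ⟩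
        [ h , a ] · (a · (t · p')) ≡⟨ cong ([ h , a ] ·_) (sym (·-assoc a t p')) ⟩
        [ h , a ] · (a · t · p')   ≡⟨ cong (λ z → [ h , a ] · (z · p')) (sym (involution-central t a (∈T⇒sq≡e t∈T))) ⟩
        [ h , a ] · (t · a · p')   ≡⟨ cong ([ h , a ] ·_) (·-assoc t a p') ⟩
        [ h , a ] · (t · (a · p')) ≡⟨ sym (·-assoc [ h , a ] t (a · p')) ⟩
        [ h , a ] · t · (a · p')   ∎)
      where
      a = if b then h₀ else e
      p = product hs ε
      p' = product hs ε'
      a∈C : a ∈G C
      a∈C = choice b
        where
        choice : ∀ b → (if b then h₀ else e) ∈G C
        choice true  = hs⊆C ∈₁
        choice false = e∈C

    module _ (hs : List GG) where

      TSpan : GG → Set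
      TSpan x = Σ (Vec Bool (length hs)) λ ε → Σ GG λ t → t ∈G Tor C × x ≡ t · product hs ε

      Preserves : GG → Set
      Preserves y = ∀ {x} → TSpan x → TSpan (y · x)

      ∣C∣≤ : (∀ c → c ∈G C → TSpan c) → ∣ C ∣ ≤ 2 ^ length hs * ∣ Tor C ∣
      ∣C∣≤ C⊆span = subst (∣ C ∣ ≤_) length-L (countL≤length C allG L Unique-allG covers)
        where
        Ts = filterᵇ (Tor C) allG
        L = concatMap (λ ε → map (_· product hs ε) Ts) (allVec (false ∷ true ∷ []) (length hs))
        covers : ∀ {x} → x ∈ allG → x ∈G C → x ∈ L
        covers {x} _ x∈C with C⊆span x x∈C
        ... | ε , t , t∈T , refl =
          ∈-concatMap _ (allVec-complete (Enumeration.complete ℤ₂-enumeration) ε)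
            (∈-map⁺ (_· product hs ε) (∈-filter⁺ _ (∈-allG t) (subst T (sym t∈T) _)))
        length-L : length L ≡ 2 ^ length hs * ∣ Tor C ∣
        length-L = trans (length-concatMap (λ ε → map (_· product hs ε) Ts) (λ ε → List.length-map _ Ts)
                                           (allVec (false ∷ true ∷ []) (length hs)))
                         (cong₂ _*_ (length-allVec (false ∷ true ∷ []) (length hs)) (length-filterᵇ (Tor C) allG))

      TSpan-e : TSpan e
      TSpan-e = replicate _ false , e , e∈T , sym (trans (·-identityˡ _) (product-false hs))
        where
        product-false : ∀ hs → product hs (replicate (length hs) false) ≡ e
        product-false []       = refl
        product-false (h ∷ hs) = trans (·-identityˡ _) (product-false hs)

      T-preserves : ∀ {t} → t ∈G Tor C → Preserves t
      T-preserves {t} t∈T (ε , t' , t'∈T , refl) = ε , t · t' , ·∈T t∈T t'∈T , sym (·-assoc t t' _)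

      preserves-· : ∀ {y y'} → Preserves y → Preserves y' → Preserves (y · y')
      preserves-· {y} {y'} y-pres y'-pres {x} x∈ = subst TSpan (sym (·-assoc y y' x)) (y-pres (y'-pres x∈))

      -- y⁻¹ = y² y with y² ∈ T(C).
      preserves-⁻¹ : ∀ {y} → y ∈G C → Preserves y → Preserves (y ⁻¹)
      preserves-⁻¹ {y} y∈C y-pres {x} x∈ =
        subst TSpan (sym (trans (cong (_· x) (⁻¹≡cube y)) (·-assoc (sq y) y x))) (T-preserves (sq∈T y∈C) (y-pres x∈))

      factor-preserves : ∀ {h} → (∀ {h'} → h' ∈ hs → h' ∈G C) → h ∈ hs → Preserves h
      factor-preserves {h} hs⊆C h∈ (ε , t , t∈T , refl)
        with ε' , t' , t'∈T , h·p≡ ← factor·product hs⊆C h∈ ε =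
        ε' , t · t' , ·∈T t∈T t'∈T , (begin
          h · (t · product hs ε)   ≡⟨ sym (·-assoc h t _) ⟩
          h · t · product hs ε     ≡⟨ cong (_· product hs ε) (sym (involution-central t h (∈T⇒sq≡e t∈T))) ⟩
          t · h · product hs ε     ≡⟨ ·-assoc t h _ ⟩
          t · (h · product hs ε)   ≡⟨ cong (t ·_) h·p≡ ⟩
          t · (t' · product hs ε') ≡⟨ sym (·-assoc t t' _) ⟩
          t · t' · product hs ε'   ∎)

      ⟨⟩-preserves : ∀ {L} → (∀ {s} → s ∈ L → s ∈G C) → (∀ {s} → s ∈ L → Preserves s) → ∀ {y} → ⟨ L ⟩ y → Preserves y
      ⟨⟩-preserves L⊆C L-pres gen-e {x} x∈        = subst TSpan (sym (·-identityˡ x)) x∈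
      ⟨⟩-preserves L⊆C L-pres (gen-mul s∈ y∈) = preserves-· (L-pres s∈) (⟨⟩-preserves L⊆C L-pres y∈)
      ⟨⟩-preserves L⊆C L-pres (gen-inv s∈ y∈) =
        preserves-· (preserves-⁻¹ (L⊆C s∈) (L-pres s∈)) (⟨⟩-preserves L⊆C L-pres y∈)

      C⊆TSpan : ∀ {L} → Generates L C → (∀ {s} → s ∈ L → Preserves s) → ∀ c → c ∈G C → TSpan c
      C⊆TSpan L-gen L-pres c c∈C =
        subst TSpan (·-identityʳ c)
          (⟨⟩-preserves (λ s∈ → proj₂ (L-gen _) (⟨⟩-generator s∈)) L-pres (proj₁ (L-gen c) c∈C) TSpan-e)

-- The three statements for an abelian part of C without square roots of u

halve : ∀ {h N} → 2 * h ≡ N → h ≡ N / 2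
halve {h} refl = sym (trans (cong (_/ 2) (ℕ.*-comm 2 h)) (m*n/n≡m h 2))

4x≡2x+2x : ∀ x → 4 * x ≡ 2 * x + 2 * x
4x≡2x+2x = solve-∀

4x≡x⇒x≡0 : ∀ x → 4 * x ≡ x → x ≡ 0
4x≡x⇒x≡0 x eq = ℕ.m+n≡0⇒m≡0 x (ℕ.+-cancelˡ-≡ x (3 * x) 0 (trans eq (sym (ℕ.+-identityʳ x))))

quarter : ∀ {s N} → 4 * s ≡ N → s ≡ N / 4
quarter {s} refl = sym (trans (cong (_/ 4) (ℕ.*-comm 4 s)) (m*n/n≡m s 4))

sum-of-halves : ∀ h h' {n} → 2 * h ≡ n → 2 * h' ≡ n → h + h' ≡ n
sum-of-halves h h' {n} 2h≡n 2h'≡n = begin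
  h + h' ≡⟨ cong (h +_) (ℕ.*-cancelˡ-≡ h' h 2 (trans 2h'≡n (sym 2h≡n))) ⟩
  h + h  ≡⟨ cong (h +_) (sym (ℕ.+-identityʳ h)) ⟩
  2 * h  ≡⟨ 2h≡n ⟩
  n      ∎
  where open ≡-Reasoning

quarter-of-halves : ∀ a b c s {n} → 2 * a ≡ n → 2 * b ≡ n → 2 * c ≡ n → a + b ≡ c + 2 * s → 4 * s ≡ n
quarter-of-halves a b c s {n} 2a≡n 2b≡n 2c≡n a+b≡c+2s = begin
  4 * s       ≡⟨ ℕ.*-assoc 2 2 s ⟩
  2 * (2 * s) ≡⟨ cong (2 *_) (sym (ℕ.+-cancelˡ-≡ a a (2 * s) (begin
    a + a       ≡⟨ cong (a +_) (ℕ.*-cancelˡ-≡ a b 2 (trans 2a≡n (sym 2b≡n))) ⟩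
    a + b       ≡⟨ a+b≡c+2s ⟩
    c + 2 * s   ≡⟨ cong (_+ 2 * s) (ℕ.*-cancelˡ-≡ c a 2 (trans 2c≡n (sym 2a≡n))) ⟩
    a + 2 * s   ∎))) ⟩
  2 * a       ≡⟨ 2a≡n ⟩
  n           ∎
  where open ≡-Reasoning

-- The properties of R(C) from which all three statements follow.
record IsAbelianWithoutSqrtU {k1 k2 k3} (C : SubsetG {k1} {k2} {k3}) (P : G k1 k2 k3 → Set) : Set where
  field
    ·-closed : ∀ {x y} → P x → P y → P (x · y)
    ⊆C       : ∀ {x} → P x → x ∈G C
    abelian  : ∀ {x y} → P x → P y → x · y ≡ y · x
    sq≢u     : ∀ {x} → P x → sq x ≢ u

module HadamardSubgroup {k1 k2 k3 : ℕ} (m : ℕ) (C : SubsetG {k1} {k2} {k3}) (C-subgroup : IsSubgroup C)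
                    (length≡n : k1 + 2 * k2 + 4 * k3 ≡ 2 ^ m) (hadamard : IsHadamardCode (2 ^ m) (ΦImage C)) where

  open Subgroup C C-subgroup
  open ≡-Reasoning

  private
    GG = G k1 k2 k3
    n = 2 ^ m

  n≢0 : n ≢ 0
  n≢0 n≡0 with () ← ℕ.m^n≡0⇒m≡0 2 m n≡0

  weight≡n⇒≡u : ∀ (c : GG) → wt c ≡ n → c ≡ u
  weight≡n⇒≡u c wt≡n = begin
    c           ≡⟨ sym (·-identityʳ c) ⟩
    c · e       ≡⟨ cong (c ·_) (sym square-υ) ⟩
    c · (u · u) ≡⟨ sym (·-assoc c u u) ⟩
    c · u · u   ≡⟨ cong (_· u) c·u≡e ⟩
    e · u       ≡⟨ ·-identityˡ u ⟩
    u           ∎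
    where
    c·u≡e : c · u ≡ e
    c·u≡e = weight≡0⇒≡ε (c · u)
      (ℕ.+-cancelʳ-≡ n _ 0 (trans (cong (wt (c · u) +_) (sym wt≡n)) (trans (weight-∙υ c) length≡n)))

  u≢e : u ≢ e {k1} {k2} {k3}
  u≢e u≡e = n≢0 (begin
    n                     ≡⟨ sym length≡n ⟩
    k1 + 2 * k2 + 4 * k3  ≡⟨ sym (weight-∙υ (e {k1} {k2} {k3})) ⟩
    _                     ≡⟨ cong₂ _+_ (cong wt (trans (·-identityˡ u) u≡e)) (weight-ε {k1} {k2} {k3}) ⟩
    wt (e {k1} {k2} {k3}) + 0 ≡⟨ cong (_+ 0) (weight-ε {k1} {k2} {k3}) ⟩
    0                     ∎)

  -- The Hadamard code has only the weights 0, n/2 and n, attained by e and u.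
  half-weight : ∀ {c} → c ∈G C → c ≢ e → c ≢ u → 2 * wt c ≡ n
  half-weight {c} c∈C c≢e c≢u with codeword-weight n hadamard (c , c∈C , refl)
  ... | inj₁ wt≡0         = ⊥-elim (c≢e (weight≡0⇒≡ε c wt≡0))
  ... | inj₂ (inj₁ wt≡n)  = ⊥-elim (c≢u (weight≡n⇒≡u c wt≡n))
  ... | inj₂ (inj₂ 2wt≡n) = 2wt≡n

  quarter-weight∉C : ∀ {c} → 4 * wt c ≡ n → c ∉G C
  quarter-weight∉C {c} 4w≡n with C c in c∈C
  ... | false = refl
  ... | true with codeword-weight n hadamard (c , c∈C , refl)
  ...   | inj₁ w≡0         = ⊥-elim (n≢0 (trans (sym 4w≡n) (cong (4 *_) w≡0)))
  ...   | inj₂ (inj₁ w≡n)  = ⊥-elim (n≢0 (4x≡x⇒x≡0 n (trans (cong (4 *_) (sym w≡n)) 4w≡n)))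
  ...   | inj₂ (inj₂ 2w≡n) = ⊥-elim (n≢0 (trans (sym 2w≡n) (ℕ.+-cancelˡ-≡ (2 * wt c) _ 0 (begin
    2 * wt c + 2 * wt c ≡⟨ sym (4x≡2x+2x (wt c)) ⟩
    4 * wt c            ≡⟨ trans 4w≡n (sym 2w≡n) ⟩
    2 * wt c            ≡⟨ sym (ℕ.+-identityʳ _) ⟩
    2 * wt c + 0        ∎))))

  module _ {P : GG → Set} (P-good : IsAbelianWithoutSqrtU C P) where
    open IsAbelianWithoutSqrtU P-good

    sq-half-weight : ∀ {x} → P x → x ∉G Tor C → 2 * wt (sq x) ≡ n
    sq-half-weight x∈P x∉T = half-weight (sq∈C (⊆C x∈P)) (∉T⇒sq≢e (⊆C x∈P) x∉T) (sq≢u x∈P)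

    ·∉T : ∀ {x y} → P x → P y → (y · x ⁻¹) ∉G Tor C → (x · y) ∉G Tor C
    ·∉T {x} {y} x∈P y∈P yx⁻¹∉T = ¬∈⇒∉ (Tor C) λ xy∈T → ∉⇒¬∈ (Tor C) yx⁻¹∉T
      (∈T-intro (·∈C (⊆C y∈P) (⁻¹∈C (⊆C x∈P))) (trans (sq-·⁻¹ x y (abelian x∈P y∈P)) (∈T⇒sq≡e xy∈T)))

    swapper-quarter-weight : ∀ {x y} → P x → P y → x ∉G Tor C → y ∉G Tor C → (y · x ⁻¹) ∉G Tor C →
                             4 * wt ⟪ x ∶ y ⟫ ≡ n
    swapper-quarter-weight {x} {y} x∈P y∈P x∉T y∉T yx⁻¹∉T =
      quarter-of-halves (wt (sq x)) (wt (sq y)) (wt (sq (x · y))) (wt ⟪ x ∶ y ⟫)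
        (sq-half-weight x∈P x∉T) (sq-half-weight y∈P y∉T) (sq-half-weight (·-closed x∈P y∈P) (·∉T x∈P y∈P yx⁻¹∉T))
        (weight-square-∙ x y (abelian x∈P y∈P))

    -- If (a:b) = (y:z), the weights of (ay:b), (a:b) and (y:b) force (ay:b) = e, and then
    -- the square of ayb would have weight n/2 + n/2 = n, i.e. it would be u.
    swapper-separates : ∀ {a b y z} → P a → P b → P y → P z → a ∉G Tor C → b ∉G Tor C → y ∉G Tor C →
                        (b · a ⁻¹) ∉G Tor C → (y · a ⁻¹) ∉G Tor C → (b · y ⁻¹) ∉G Tor C → ⟪ a ∶ b ⟫ ≢ ⟪ y ∶ z ⟫
    swapper-separates {a} {b} {y} {z} a∈P b∈P y∈P z∈P a∉T b∉T y∉T ba⁻¹∉T ya⁻¹∉T by⁻¹∉T ab≡yz =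
      sq≢u (·-closed ay∈P b∈P) (weight≡n⇒≡u _ (begin
        wt (sq (a · y · b))                  ≡⟨ sym (ℕ.+-identityʳ _) ⟩
        wt (sq (a · y · b)) + 2 * 0          ≡⟨ cong (λ w → wt (sq (a · y · b)) + 2 * w) (sym ay:b≡0) ⟩
        wt (sq (a · y · b)) + 2 * wt ⟪ a · y ∶ b ⟫ ≡⟨ sym (weight-square-∙ (a · y) b (abelian ay∈P b∈P)) ⟩
        wt (sq (a · y)) + wt (sq b)          ≡⟨ sum-of-halves (wt (sq (a · y))) (wt (sq b))
                                                  (sq-half-weight ay∈P (·∉T a∈P y∈P ya⁻¹∉T)) (sq-half-weight b∈P b∉T) ⟩
        n                                    ∎))
      where
      ay∈P = ·-closed a∈P y∈P
      ay:b≡0 : wt ⟪ a · y ∶ b ⟫ ≡ 0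
      ay:b≡0 = ℕ.+-cancelʳ-≡ (wt ⟪ a ∶ b ⟫) _ 0 (begin
        wt ⟪ a · y ∶ b ⟫ + wt ⟪ a ∶ b ⟫ ≡⟨ weight-swap-∙ˡ a b y z (abelian a∈P b∈P) (abelian a∈P y∈P) (abelian a∈P z∈P)
                                             (abelian b∈P y∈P) (abelian b∈P z∈P) (abelian y∈P z∈P) ab≡yz ⟩
        wt ⟪ y ∶ b ⟫                    ≡⟨ ℕ.*-cancelˡ-≡ _ _ 4 (trans (swapper-quarter-weight y∈P b∈P y∉T b∉T by⁻¹∉T)
                                                               (sym (swapper-quarter-weight a∈P b∈P a∉T b∉T ba⁻¹∉T))) ⟩
        wt ⟪ a ∶ b ⟫                    ∎)

    square-balanced : ∀ {x} → P x → x ∉G Tor C → (sq x ≢ e × sq x ≢ u) × wt (sq x) ≡ n / 2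
    square-balanced x∈P x∉T = (∉T⇒sq≢e (⊆C x∈P) x∉T , sq≢u x∈P) , halve (sq-half-weight x∈P x∉T)

    ∉T⇒≢ : ∀ {x y} → (y · x ⁻¹) ∉G Tor C → y ≢ x
    ∉T⇒≢ {x} yx⁻¹∉T refl = ∉⇒¬∈ (Tor C) yx⁻¹∉T (subst (_∈G Tor C) (sym (·-inverseʳ x)) e∈T)

    swapper-injective : ∀ {a b} → P a → P b → a ∉G Tor C → b ∉G Tor C → (b · a ⁻¹) ∉G Tor C →
      (a' b' : GG) → P a' → P b' → a' ∉G Tor C → b' ∉G Tor C → (b' · a' ⁻¹) ∉G Tor C →
      ¬ (a' ≡ a × b' ≡ b) → ¬ (a' ≡ b × b' ≡ a) →
      ((x y : GG) → x ∈ (a ∷ b ∷ a' ∷ b' ∷ []) → y ∈ (a ∷ b ∷ a' ∷ b' ∷ []) → x ≢ y → (y · x ⁻¹) ∉G Tor C) →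
      ⟪ a ∶ b ⟫ ≢ ⟪ a' ∶ b' ⟫
    swapper-injective {a} {b} a∈P b∈P a∉T b∉T ba⁻¹∉T a' b' a'∈P b'∈P a'∉T b'∉T b'a'⁻¹∉T ≢same ≢swapped distinct
      with a' ≟G a | a' ≟G b
    ... | no a'≢a | no a'≢b = swapper-separates a∈P b∈P a'∈P b'∈P a∉T b∉T a'∉T ba⁻¹∉T
                                (distinct a a' ∈₁ ∈₃ (λ a≡a' → a'≢a (sym a≡a'))) (distinct a' b ∈₃ ∈₂ a'≢b)
    ... | yes refl | _ = λ ab≡ab' → swapper-separates a∈P b∈P b'∈P a'∈P a∉T b∉T b'∉T ba⁻¹∉T
                                (distinct a b' ∈₁ ∈₄ (λ a≡b' → ∉T⇒≢ b'a'⁻¹∉T (sym a≡b')))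
                                (distinct b' b ∈₄ ∈₂ (λ b'≡b → ≢same (refl , b'≡b)))
                                (trans ab≡ab' (swap-comm a' b' (abelian a'∈P b'∈P)))
    ... | no _ | yes refl = λ ab≡ab' → swapper-separates a∈P b∈P b'∈P a'∈P a∉T b∉T b'∉T ba⁻¹∉T
                                (distinct a b' ∈₁ ∈₄ (λ a≡b' → ≢swapped (refl , sym a≡b')))
                                (distinct b' b ∈₄ ∈₂ (∉T⇒≢ b'a'⁻¹∉T))
                                (trans ab≡ab' (swap-comm a' b' (abelian a'∈P b'∈P)))

-- R(C) for each shape of standard generators

module StandardGenerators {k1 k2 k3 : ℕ} (C : SubsetG {k1} {k2} {k3}) (C-subgroup : IsSubgroup C)
                          (u≢e : u ≢ e {k1} {k2} {k3}) where

  open Subgroup C C-subgroup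
  open Span C C-subgroup
  open ≡-Reasoning

  private
    GG = G k1 k2 k3

  generator∈ : ∀ {S : List GG} {P} → Generates S P → ∀ {s} → s ∈ S → s ∈G P
  generator∈ S-gen {s} s∈ = proj₂ (S-gen s) (⟨⟩-generator s∈)

  Rgens⊆ : ∀ (xs rs : List GG) → Rgens xs rs ⊆ xs ++ rs
  Rgens⊆ xs []       s∈ = ∈-++⁺ˡ s∈
  Rgens⊆ xs (r ∷ rs) s∈ with sq r == u
  ... | false = s∈
  ... | true with ∈-++⁻ xs s∈
  ...   | inj₁ s∈xs = ∈-++⁺ˡ s∈xs
  ...   | inj₂ s∈rs = ∈-++⁺ʳ xs (there s∈rs)

  Rgens-sqrt-u : ∀ (xs : List GG) {r} rs → (sq r == u) ≡ true → Rgens xs (r ∷ rs) ≡ xs ++ rs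
  Rgens-sqrt-u xs rs r²==u rewrite r²==u = refl

  Rgens-no-sqrt-u : ∀ (xs : List GG) {r} rs → (sq r == u) ≡ false → Rgens xs (r ∷ rs) ≡ xs ++ r ∷ rs
  Rgens-no-sqrt-u xs rs r²==u rewrite r²==u = refl

  ≡u⇒==u : ∀ {x : GG} → x ≡ u → (x == u) ≡ true
  ≡u⇒==u refl = ==-refl (u {k1} {k2} {k3})

  ++⊆C : ∀ {xs W : List GG} → (∀ {s} → s ∈ xs → s ∈G Tor C) → (∀ {w} → w ∈ W → w ∈G C) → ∀ {s} → s ∈ xs ++ W → s ∈G C
  ++⊆C {xs} xs⊆T W⊆C s∈ with ∈-++⁻ xs s∈
  ... | inj₁ s∈xs = ∈T⇒∈C (xs⊆T s∈xs)
  ... | inj₂ s∈W  = W⊆C s∈W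

  ++-commuting : ∀ {xs W : List GG} → (∀ {s} → s ∈ xs → s ∈G Tor C) → PairwiseCommuting W → PairwiseCommuting (xs ++ W)
  ++-commuting {xs} xs⊆T W-comm {s} {s'} s∈ s'∈ with ∈-++⁻ xs s∈ | ∈-++⁻ xs s'∈
  ... | inj₁ s∈xs | _          = ∈T⇒central (xs⊆T s∈xs) s'
  ... | inj₂ _    | inj₁ s'∈xs = trans ([,]-comm s s') (∈T⇒central (xs⊆T s'∈xs) s)
  ... | inj₂ s∈W  | inj₂ s'∈W  = W-comm s∈W s'∈W

  singleton-commuting : ∀ {w : GG} → PairwiseCommuting (w ∷ [])
  singleton-commuting ∈₁ ∈₁ = [,]-self _

  good-via : ∀ xs rs {L} → Rgens xs rs ⊆ L → (∀ {s} → s ∈ L → s ∈G C) → PairwiseCommuting L →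
             (∀ {x} → ⟨ L ⟩ x → sq x ≢ u) → IsAbelianWithoutSqrtU C (R xs rs)
  good-via xs rs Rgens⊆L L⊆C L-comm sq≢u = record
    { ·-closed = ⟨⟩-·
    ; ⊆C       = λ x∈R → ⟨⟩⊆C L⊆C (⟨⟩-mono Rgens⊆L x∈R)
    ; abelian  = λ x∈R y∈R → [,]≡e⇒comm _ _ (⟨⟩-abelian L-comm (⟨⟩-mono Rgens⊆L x∈R) (⟨⟩-mono Rgens⊆L y∈R))
    ; sq≢u     = λ x∈R → sq≢u (⟨⟩-mono Rgens⊆L x∈R) }

  ⟨involutions⟩ : ∀ {p r : GG} → sq p ≡ e → sq r ≡ e → ∀ {v} → ⟨ p ∷ r ∷ [] ⟩ v → v ≡ e ⊎ v ≡ p ⊎ v ≡ r ⊎ v ≡ p · r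
  ⟨involutions⟩ {p} {r} p²≡e r²≡e = elements
    where
    Among : GG → Set
    Among v = v ≡ e ⊎ v ≡ p ⊎ v ≡ r ⊎ v ≡ p · r
    pr≡rp = involution-central p r p²≡e
    p·- : ∀ {v} → Among v → Among (p · v)
    p·- (inj₁ refl)               = inj₂ (inj₁ (·-identityʳ p))
    p·- (inj₂ (inj₁ refl))        = inj₁ p²≡e
    p·- (inj₂ (inj₂ (inj₁ refl))) = inj₂ (inj₂ (inj₂ refl))
    p·- (inj₂ (inj₂ (inj₂ refl))) =
      inj₂ (inj₂ (inj₁ (trans (sym (·-assoc p p r)) (trans (cong (_· r) p²≡e) (·-identityˡ r)))))
    r·- : ∀ {v} → Among v → Among (r · v)
    r·- (inj₁ refl)               = inj₂ (inj₂ (inj₁ (·-identityʳ r)))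
    r·- (inj₂ (inj₁ refl))        = inj₂ (inj₂ (inj₂ (sym pr≡rp)))
    r·- (inj₂ (inj₂ (inj₁ refl))) = inj₁ r²≡e
    r·- (inj₂ (inj₂ (inj₂ refl))) = inj₂ (inj₁ (begin
      r · (p · r) ≡⟨ cong (r ·_) pr≡rp ⟩
      r · (r · p) ≡⟨ sym (·-assoc r r p) ⟩
      sq r · p    ≡⟨ cong (_· p) r²≡e ⟩
      e · p       ≡⟨ ·-identityˡ p ⟩
      p           ∎))
    involution⁻¹ : ∀ {s : GG} → sq s ≡ e → s ⁻¹ ≡ s
    involution⁻¹ {s} s²≡e = trans (⁻¹≡cube s) (trans (cong (_· s) s²≡e) (·-identityˡ s))
    elements : ∀ {v} → ⟨ p ∷ r ∷ [] ⟩ v → Among v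
    elements gen-e                   = inj₁ refl
    elements (gen-mul ∈₁ v∈)         = p·- (elements v∈)
    elements (gen-mul ∈₂ v∈)         = r·- (elements v∈)
    elements (gen-inv {x = v} ∈₁ v∈) =
      subst (λ q → Among (q · v)) (sym (involution⁻¹ p²≡e)) (p·- (elements v∈))
    elements (gen-inv {x = v} ∈₂ v∈) =
      subst (λ q → Among (q · v)) (sym (involution⁻¹ r²≡e)) (r·- (elements v∈))

  -- The squares of ⟨xs ++ W⟩ lie in ⟨p , r⟩ = {e, p, r, pr}, which avoids u.
  sq≢u-via-involutions : ∀ {xs W : List GG} {p r} → (∀ {s} → s ∈ xs → s ∈G Tor C) → PairwiseCommuting (xs ++ W) →
                         (∀ {w} → w ∈ W → ⟨ p ∷ r ∷ [] ⟩ (sq w)) → sq p ≡ e → sq r ≡ e → p ≢ u → r ≢ u → p · r ≢ u →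
                         ∀ {x} → ⟨ xs ++ W ⟩ x → sq x ≢ u
  sq≢u-via-involutions {xs} {W} {p} {r} xs⊆T L-comm sqW p²≡e r²≡e p≢u r≢u pr≢u x∈ sq≡u
    with ⟨involutions⟩ p²≡e r²≡e (sq-⟨⟩ L-comm sq-generator x∈)
    where
    sq-generator : ∀ {s} → s ∈ xs ++ W → ⟨ p ∷ r ∷ [] ⟩ (sq s)
    sq-generator {s} s∈ with ∈-++⁻ xs s∈
    ... | inj₁ s∈xs = subst ⟨ _ ⟩ (sym (∈T⇒sq≡e (xs⊆T s∈xs))) gen-e
    ... | inj₂ s∈W  = sqW s∈W
  ... | inj₁ sq≡e               = u≢e (trans (sym sq≡u) sq≡e)
  ... | inj₂ (inj₁ sq≡p)        = p≢u (trans (sym sq≡p) sq≡u)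
  ... | inj₂ (inj₂ (inj₁ sq≡r)) = r≢u (trans (sym sq≡r) sq≡u)
  ... | inj₂ (inj₂ (inj₂ sq≡pr)) = pr≢u (trans (sym sq≡pr) sq≡u)

  good-via-one-generator : ∀ (xs rs : List GG) {w} → Rgens xs rs ⊆ xs ++ w ∷ [] → (∀ {s} → s ∈ xs → s ∈G Tor C) →
                           w ∈G C → sq w ≢ u → IsAbelianWithoutSqrtU C (R xs rs)
  good-via-one-generator xs rs {w} Rgens⊆L xs⊆T w∈C w²≢u =
    good-via xs rs Rgens⊆L (++⊆C xs⊆T λ { ∈₁ → w∈C }) L-comm
      (sq≢u-via-involutions xs⊆T L-comm (λ { ∈₁ → ⟨⟩-generator ∈₁ })
        (square-square w) (square-square w) w²≢u w²≢u (λ w⁴≡u → u≢e (trans (sym w⁴≡u) (square-square w))))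
    where
    L-comm = ++-commuting xs⊆T singleton-commuting

  shape3-good : ∀ {xs z₁ ws} → NormGens C xs [] (z₁ ∷ ws) → ¬ ⟨ map sq ws ⟩ u →
                (∀ w w' → w ∈ ws → w' ∈ ws → [ w , w' ] ≡ e) → IsAbelianWithoutSqrtU C (R xs ws)
  shape3-good {xs} {z₁} {ws} (C-gen , T-gen , _) u∉⟨ws²⟩ ws-comm =
    good-via xs ws (Rgens⊆ xs ws) (++⊆C xs⊆T λ w∈ → generator∈ C-gen (∈-++⁺ʳ xs (there w∈))) L-comm
      λ x∈ sq≡u → u∉⟨ws²⟩ (subst ⟨ _ ⟩ sq≡u (sq-⟨⟩ L-comm sq-generator x∈))
    where
    xs⊆T = generator∈ T-gen
    L-comm = ++-commuting xs⊆T (ws-comm _ _)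
    sq-generator : ∀ {s} → s ∈ xs ++ ws → ⟨ map sq ws ⟩ (sq s)
    sq-generator s∈ with ∈-++⁻ xs s∈
    ... | inj₁ s∈xs = subst ⟨ _ ⟩ (sym (∈T⇒sq≡e (xs⊆T s∈xs))) gen-e
    ... | inj₂ s∈ws = ⟨⟩-generator (∈-map⁺ sq s∈ws)

  shape4-good : ∀ {xs z₁ z₂} → NormGens C xs [] (z₁ ∷ z₂ ∷ []) → sq z₁ ≢ u → IsAbelianWithoutSqrtU C (R xs (z₁ ∷ []))
  shape4-good {xs} {z₁} (C-gen , T-gen , _) z₁²≢u =
    good-via-one-generator xs (z₁ ∷ []) (Rgens⊆ xs _) (generator∈ T-gen) (generator∈ C-gen (∈-++⁺ʳ xs ∈₁)) z₁²≢u

  f5-cases : (w₃ w₄ w : GG) → f5 w₃ w₄ w ≡ w₃ ⊎ f5 w₃ w₄ w ≡ w₄ ⊎ f5 w₃ w₄ w ≡ w₃ · w₄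
  f5-cases w₃ w₄ w with [ w , w₃ ] == e
  ... | true = inj₁ refl
  ... | false with [ w , w₄ ] == e
  ...   | true  = inj₂ (inj₁ refl)
  ...   | false = inj₂ (inj₂ refl)

  shape5-good : ∀ {xs z₁ z₂ z₃ z₄} → NormGens C xs [] (z₁ ∷ z₂ ∷ z₃ ∷ z₄ ∷ []) → sq z₁ ≡ u →
                u ≢ sq z₃ → sq z₃ ≡ sq z₄ → sq z₄ ≡ [ z₃ , z₄ ] → IsAbelianWithoutSqrtU C (R xs (z₁ ∷ f5 z₃ z₄ z₁ ∷ []))
  shape5-good {xs} {z₁} {z₂} {z₃} {z₄} (C-gen , T-gen , _) z₁²≡u u≢z₃² z₃²≡z₄² z₄²≡[z₃,z₄] =
    good-via-one-generator xs (z₁ ∷ f ∷ [])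
      (subst (_⊆ xs ++ f ∷ []) (sym (Rgens-sqrt-u xs (f ∷ []) (≡u⇒==u z₁²≡u))) (λ s∈ → s∈))
      (generator∈ T-gen) f∈C (λ f²≡u → u≢z₃² (trans (sym f²≡u) f²≡z₃²))
    where
    f = f5 z₃ z₄ z₁
    z₃∈C = generator∈ C-gen (∈-++⁺ʳ xs ∈₃)
    z₄∈C = generator∈ C-gen (∈-++⁺ʳ xs ∈₄)
    f∈C : f ∈G C
    f∈C with f5-cases z₃ z₄ z₁
    ... | inj₁ f≡         = subst (_∈G C) (sym f≡) z₃∈C
    ... | inj₂ (inj₁ f≡)  = subst (_∈G C) (sym f≡) z₄∈C
    ... | inj₂ (inj₂ f≡)  = subst (_∈G C) (sym f≡) (·∈C z₃∈C z₄∈C)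
    f²≡z₃² : sq f ≡ sq z₃
    f²≡z₃² with f5-cases z₃ z₄ z₁
    ... | inj₁ f≡         = cong sq f≡
    ... | inj₂ (inj₁ f≡)  = trans (cong sq f≡) (sym z₃²≡z₄²)
    ... | inj₂ (inj₂ f≡)  = begin
      sq f                          ≡⟨ cong sq f≡ ⟩
      sq (z₃ · z₄)                  ≡⟨ sq-· z₃ z₄ ⟩
      sq z₃ · sq z₄ · [ z₃ , z₄ ]   ≡⟨ cong₂ (λ a b → sq z₃ · a · b) (sym z₃²≡z₄²)
                                             (trans (sym z₄²≡[z₃,z₄]) (sym z₃²≡z₄²)) ⟩
      sq z₃ · sq z₃ · sq z₃         ≡⟨ cong (_· sq z₃) (square-square z₃) ⟩
      e · sq z₃                     ≡⟨ ·-identityˡ _ ⟩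
      sq z₃                         ∎

  shape4*-good : ∀ {xs y₁ z₁ z₂} → NormGens C xs (y₁ ∷ []) (z₁ ∷ z₂ ∷ []) → sq z₁ ≢ u →
                 IsAbelianWithoutSqrtU C (R xs (y₁ · z₁ ∷ z₁ ∷ []))
  shape4*-good {xs} {y₁} {z₁} {z₂} (C-gen , T-gen , _ , Z-gen , _ , C-card) z₁²≢u = by-cases _ refl
    where
    W = y₁ · z₁ ∷ z₁ ∷ []
    xs⊆T = generator∈ T-gen
    y₁∈C = generator∈ C-gen (∈-++⁺ʳ xs ∈₁)
    z₁∈C = generator∈ C-gen (∈-++⁺ʳ xs ∈₂)
    z₂∈C = generator∈ C-gen (∈-++⁺ʳ xs ∈₃)
    y₁∈Z = generator∈ Z-gen (∈-++⁺ʳ xs ∈₁)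
    y₁-central : ∀ {c} → c ∈G C → [ y₁ , c ] ≡ e
    y₁-central c∈C = comm⇒[,]≡e _ _ (∈Z⇒comm y₁∈Z c∈C)
    [y₁z₁,z₁]≡e : [ y₁ · z₁ , z₁ ] ≡ e
    [y₁z₁,z₁]≡e = trans ([,]-·ˡ y₁ z₁ z₁) (trans (cong₂ _·_ (y₁-central z₁∈C) ([,]-self z₁)) sq-e)
    W-comm : PairwiseCommuting W
    W-comm ∈₁ ∈₁ = [,]-self _
    W-comm ∈₁ ∈₂ = [y₁z₁,z₁]≡e
    W-comm ∈₂ ∈₁ = trans ([,]-comm z₁ _) [y₁z₁,z₁]≡e
    W-comm ∈₂ ∈₂ = [,]-self _
    L-comm = ++-commuting xs⊆T W-comm
    pr≡y₁² : sq (y₁ · z₁) · sq z₁ ≡ sq y₁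
    pr≡y₁² = begin
      sq (y₁ · z₁) · sq z₁   ≡⟨ cong (_· sq z₁) (sq-·-comm y₁ z₁ (y₁-central z₁∈C)) ⟩
      sq y₁ · sq z₁ · sq z₁  ≡⟨ ·-assoc (sq y₁) (sq z₁) (sq z₁) ⟩
      sq y₁ · sq (sq z₁)     ≡⟨ cong (sq y₁ ·_) (square-square z₁) ⟩
      sq y₁ · e              ≡⟨ ·-identityʳ _ ⟩
      sq y₁                  ∎
    -- A central square root of u would make C abelian, against |C| = 4 |Z(C)|.
    y₁²≢u : sq y₁ ≢ u
    y₁²≢u y₁²≡u = ℕ.<⇒≢ (countL-pos C (∈-allG e) e∈C) (sym (4x≡x⇒x≡0 ∣ C ∣ (sym (begin
      ∣ C ∣          ≡⟨ C-card ⟩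
      4 * ∣ Cen C ∣  ≡⟨ cong (4 *_) (countL-cong Z≗C allG) ⟩
      4 * ∣ C ∣      ∎))))
      where
      z₁z₂≡z₂z₁ = centralizer-sqrt-υ y₁ z₁ z₂ y₁²≡u (∈Z⇒comm y₁∈Z z₁∈C) (∈Z⇒comm y₁∈Z z₂∈C)
      generators-comm : PairwiseCommuting (y₁ ∷ z₁ ∷ z₂ ∷ [])
      generators-comm ∈₁ s'∈ = y₁-central (generator∈ C-gen (∈-++⁺ʳ xs s'∈))
      generators-comm s∈ ∈₁ = trans ([,]-comm _ y₁) (y₁-central (generator∈ C-gen (∈-++⁺ʳ xs s∈)))
      generators-comm ∈₂ ∈₂ = [,]-self _
      generators-comm ∈₂ ∈₃ = comm⇒[,]≡e _ _ z₁z₂≡z₂z₁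
      generators-comm ∈₃ ∈₂ = comm⇒[,]≡e _ _ (sym z₁z₂≡z₂z₁)
      generators-comm ∈₃ ∈₃ = [,]-self _
      Z≗C : ∀ x → Cen C x ≡ C x
      Z≗C x = ⇔⇒≡ ∈Z⇒∈C λ x∈C → ∈Z-intro x∈C λ c c∈C → [,]≡e⇒comm x c
        (⟨⟩-abelian (++-commuting xs⊆T generators-comm) (proj₁ (C-gen x) x∈C) (proj₁ (C-gen c) c∈C))
    by-cases : ∀ b → (sq (y₁ · z₁) == u) ≡ b → IsAbelianWithoutSqrtU C (R xs (y₁ · z₁ ∷ z₁ ∷ []))
    by-cases true  p==u = good-via-one-generator xs _
      (subst (_⊆ xs ++ z₁ ∷ []) (sym (Rgens-sqrt-u xs (z₁ ∷ []) p==u)) (λ s∈ → s∈)) xs⊆T z₁∈C z₁²≢u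
    by-cases false p==u = good-via xs _ (subst (_⊆ xs ++ W) (sym (Rgens-no-sqrt-u xs (z₁ ∷ []) p==u)) (λ s∈ → s∈))
      (++⊆C xs⊆T λ { ∈₁ → ·∈C y₁∈C z₁∈C ; ∈₂ → z₁∈C }) L-comm
      (sq≢u-via-involutions xs⊆T L-comm (λ { ∈₁ → ⟨⟩-generator ∈₁
                                           ; ∈₂ → ⟨⟩-generator ∈₂ })
         (square-square _) (square-square z₁) (λ p≡u → case trans (sym p==u) (≡u⇒==u p≡u) of λ ())
         z₁²≢u (λ pr≡u → y₁²≢u (trans (sym pr≡y₁²) pr≡u)))

  -- If every element of C is in the T(C)-span of hs, then [C : T(C)] ≤ 2 ^ length hs.
  span-too-small : ∀ {L} hs → Generates L C → (∀ {s} → s ∈ L → Preserves hs s) →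
                   ∣ C ∣ ≢ 2 ^ suc (length hs) * ∣ Tor C ∣
  span-too-small hs L-gen L-pres C-card =
    index-bound-contradiction (length hs) (countL-pos (Tor C) (∈-allG e) e∈T) C-card (∣C∣≤ hs (C⊆TSpan hs L-gen L-pres))

  -- A square root x of u in ⟨xs ++ rs⟩ makes r₁ = x (x⁻¹ r₁) redundant, since x⁻¹ r₁ ∈ T(C).
  sqrt-u-redundant : ∀ {xs r₁ rs x} → Generates xs (Tor C) → Generates (xs ++ r₁ ∷ rs) C →
                     ∣ C ∣ ≡ 2 ^ suc (length rs) * ∣ Tor C ∣ → (∀ {y z} → y ∈G C → z ∈G C → y · z ≡ z · y) →
                     sq r₁ ≡ u → ⟨ xs ++ rs ⟩ x → sq x ≢ u
  sqrt-u-redundant {xs} {r₁} {rs} {x} T-gen C-gen C-card C-abelian r₁²≡u x∈ x²≡u =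
    span-too-small rs C-gen C-generators-preserve C-card
    where
    rs⊆C : ∀ {s} → s ∈ rs → s ∈G C
    rs⊆C s∈ = generator∈ C-gen (∈-++⁺ʳ xs (there s∈))
    r₁∈C = generator∈ C-gen (∈-++⁺ʳ xs ∈₁)
    x∈C = ⟨⟩⊆C (++⊆C (generator∈ T-gen) rs⊆C) x∈
    x-preserves : Preserves rs x
    x-preserves = ⟨⟩-preserves rs (++⊆C (generator∈ T-gen) rs⊆C) L-preserve x∈
      where
      L-preserve : ∀ {s} → s ∈ xs ++ rs → Preserves rs s
      L-preserve s∈ with ∈-++⁻ xs s∈
      ... | inj₁ s∈xs = T-preserves rs (generator∈ T-gen s∈xs)
      ... | inj₂ s∈rs = factor-preserves rs rs⊆C s∈rs
    x⁻¹r₁∈T : (x ⁻¹ · r₁) ∈G Tor C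
    x⁻¹r₁∈T = ∈T-intro (·∈C (⁻¹∈C x∈C) r₁∈C) (begin
      sq (x ⁻¹ · r₁)    ≡⟨ sq-·-comm (x ⁻¹) r₁ (comm⇒[,]≡e _ _ (C-abelian (⁻¹∈C x∈C) r₁∈C)) ⟩
      sq (x ⁻¹) · sq r₁ ≡⟨ cong₂ _·_ (trans (sq-⁻¹ x) x²≡u) r₁²≡u ⟩
      u · u             ≡⟨ square-υ ⟩
      e                 ∎)
    r₁≡ : x · (x ⁻¹ · r₁) ≡ r₁
    r₁≡ = trans (sym (·-assoc x (x ⁻¹) r₁)) (trans (cong (_· r₁) (·-inverseʳ x)) (·-identityˡ r₁))
    C-generators-preserve : ∀ {s} → s ∈ xs ++ r₁ ∷ rs → Preserves rs s
    C-generators-preserve s∈ with ∈-++⁻ xs s∈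
    ... | inj₁ s∈xs         = T-preserves rs (generator∈ T-gen s∈xs)
    ... | inj₂ ∈₁  = subst (Preserves rs) r₁≡ (preserves-· rs x-preserves (T-preserves rs x⁻¹r₁∈T))
    ... | inj₂ (there s∈rs) = factor-preserves rs rs⊆C s∈rs

  shape1-good : ∀ {xs ys rs} → NormGens C xs ys [] → Generates (xs ++ rs) C → ∣ C ∣ ≡ 2 ^ length rs * ∣ Tor C ∣ →
                ((∃[ c ] (c ∈G C × sq c ≡ u)) → ∃[ r₁ ] ∃[ rs' ] (rs ≡ r₁ ∷ rs' × sq r₁ ≡ u)) →
                IsAbelianWithoutSqrtU C (R xs rs)
  shape1-good {xs} {ys} {rs} (C-gen , T-gen , _ , Z-gen , _) rs-gen C-card sqrt-u-first = record
    { ·-closed = ⟨⟩-·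
    ; ⊆C       = R⊆C
    ; abelian  = λ x∈R y∈R → C-abelian (R⊆C x∈R) (R⊆C y∈R)
    ; sq≢u     = sq≢u }
    where
    R⊆C : ∀ {x} → R xs rs x → x ∈G C
    R⊆C = ⟨⟩⊆C (λ s∈ → generator∈ rs-gen (Rgens⊆ xs rs s∈))
    C-abelian : ∀ {x y} → x ∈G C → y ∈G C → x · y ≡ y · x
    C-abelian {x} x∈C = ∈Z⇒comm (proj₂ (Z-gen x) (⟨⟩-mono (subst (λ l → xs ++ l ⊆ xs ++ ys)
                                                                  (sym (List.++-identityʳ ys)) (λ s∈ → s∈))
                                                          (proj₁ (C-gen x) x∈C)))
    sq≢u : ∀ {x} → R xs rs x → sq x ≢ u
    sq≢u {x} x∈R x²≡u =
      let r₁ , rs' , rs≡ , r₁²≡u = sqrt-u-first (x , R⊆C x∈R , x²≡u) in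
      sqrt-u-redundant T-gen (subst (λ l → Generates (xs ++ l) C) rs≡ rs-gen)
        (subst (λ l → ∣ C ∣ ≡ 2 ^ length l * ∣ Tor C ∣) rs≡ C-card) C-abelian r₁²≡u
        (subst (λ l → ⟨ l ⟩ x) (Rgens-sqrt-u xs rs' (≡u⇒==u r₁²≡u)) (subst (λ l → R xs l x) rs≡ x∈R)) x²≡u

  commutator≡sq : ∀ {xs ws : List GG} z → (∀ {s} → s ∈ xs → s ∈G Tor C) → PairwiseCommuting (xs ++ ws) →
                  (∀ {w} → w ∈ ws → [ z , w ] ≡ sq w) → ∀ {v} → ⟨ xs ++ ws ⟩ v → [ z , v ] ≡ sq v
  commutator≡sq {xs} {ws} z xs⊆T L-comm ws-sq = on-⟨⟩
    where
    on-generator : ∀ {s} → s ∈ xs ++ ws → [ z , s ] ≡ sq s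
    on-generator s∈ with ∈-++⁻ xs s∈
    ... | inj₁ s∈xs = trans ([,]-comm z _) (trans (∈T⇒central (xs⊆T s∈xs) z) (sym (∈T⇒sq≡e (xs⊆T s∈xs))))
    ... | inj₂ s∈ws = ws-sq s∈ws
    on-⟨⟩ : ∀ {v} → ⟨ xs ++ ws ⟩ v → [ z , v ] ≡ sq v
    on-⟨⟩ gen-e = trans ([,]-e z) (sym sq-e)
    on-⟨⟩ (gen-mul {s} {v} s∈ v∈) = begin
      [ z , s · v ]          ≡⟨ [,]-·ʳ z s v ⟩
      [ z , s ] · [ z , v ]  ≡⟨ cong₂ _·_ (on-generator s∈) (on-⟨⟩ v∈) ⟩
      sq s · sq v            ≡⟨ sym (sq-·-comm s v (⟨⟩-centralized s (L-comm s∈) v∈)) ⟩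
      sq (s · v)             ∎
    on-⟨⟩ (gen-inv {s} {v} s∈ v∈) = begin
      [ z , s ⁻¹ · v ]          ≡⟨ [,]-·ʳ z (s ⁻¹) v ⟩
      [ z , s ⁻¹ ] · [ z , v ]  ≡⟨ cong₂ _·_ (trans ([,]-⁻¹ʳ z s) (on-generator s∈)) (on-⟨⟩ v∈) ⟩
      sq s · sq v               ≡⟨ cong (_· sq v) (sym (sq-⁻¹ s)) ⟩
      sq (s ⁻¹) · sq v          ≡⟨ sym (sq-·-comm (s ⁻¹) v (trans ([,]-⁻¹ˡ s v) (⟨⟩-centralized s (L-comm s∈) v∈))) ⟩
      sq (s ⁻¹ · v)             ∎

  -- A square root x of u in ⟨xs ++ ws⟩ makes y = x z₁ z₂ central, hence y ∈ T(C), so that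
  -- z₂ = z₁⁻¹ x⁻¹ y is redundant.
  z₂-redundant : ∀ {xs z₁ z₂ ws x} → Generates xs (Tor C) → Generates (xs ++ z₁ ∷ z₂ ∷ ws) C →
                 Generates (xs ++ []) (Cen C) → ∣ C ∣ ≡ 2 ^ suc (length (z₁ ∷ ws)) * ∣ Tor C ∣ → [ z₁ , z₂ ] ≡ u →
                 (∀ {w} → w ∈ ws → [ z₁ , w ] ≡ sq w × [ z₂ , w ] ≡ sq w) → PairwiseCommuting (xs ++ ws) →
                 ⟨ xs ++ ws ⟩ x → sq x ≢ u
  z₂-redundant {xs} {z₁} {z₂} {ws} {x} T-gen C-gen Z-gen C-card [z₁,z₂]≡u ws-sq L-comm x∈ x²≡u =
    span-too-small hs C-gen C-generators-preserve C-card
    where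
    hs = z₁ ∷ ws
    xs⊆T = generator∈ T-gen
    hs⊆C : ∀ {h} → h ∈ hs → h ∈G C
    hs⊆C ∈₁ = generator∈ C-gen (∈-++⁺ʳ xs ∈₁)
    hs⊆C (there w∈)  = generator∈ C-gen (∈-++⁺ʳ xs (there (there w∈)))
    L⊆C = ++⊆C xs⊆T (λ w∈ → hs⊆C (there w∈))
    [x,zᵢ]≡u : ∀ {z} → (∀ {w} → w ∈ ws → [ z , w ] ≡ sq w) → [ x , z ] ≡ u
    [x,zᵢ]≡u ws-sqᵢ = trans ([,]-comm x _) (trans (commutator≡sq _ xs⊆T L-comm ws-sqᵢ x∈) x²≡u)
    y = x · (z₁ · z₂)
    [y,generator]≡e : ∀ {h} → h ∈ xs ++ z₁ ∷ z₂ ∷ ws → [ y , h ] ≡ e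
    [y,generator]≡e {h} h∈ = trans ([,]-·ˡ x (z₁ · z₂) h) (trans (cong ([ x , h ] ·_) ([,]-·ˡ z₁ z₂ h)) (cases h∈))
      where
      cases : ∀ {h} → h ∈ xs ++ z₁ ∷ z₂ ∷ ws → [ x , h ] · ([ z₁ , h ] · [ z₂ , h ]) ≡ e
      cases h∈ with ∈-++⁻ xs h∈
      ... | inj₁ h∈xs =
        trans (cong₂ _·_ (central x) (cong₂ _·_ (central z₁) (central z₂))) (trans (cong (e ·_) sq-e) sq-e)
        where central = λ g → trans ([,]-comm g _) (∈T⇒central (xs⊆T h∈xs) g)
      ... | inj₂ ∈₁ =
        trans (cong₂ _·_ ([x,zᵢ]≡u (λ w∈ → proj₁ (ws-sq w∈)))
                         (cong₂ _·_ ([,]-self z₁) (trans ([,]-comm z₂ z₁) [z₁,z₂]≡u)))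
              (trans (cong (u ·_) (·-identityˡ u)) square-υ)
      ... | inj₂ ∈₂ =
        trans (cong₂ _·_ ([x,zᵢ]≡u (λ w∈ → proj₂ (ws-sq w∈))) (cong₂ _·_ [z₁,z₂]≡u ([,]-self z₂)))
              (trans (cong (u ·_) (·-identityʳ u)) square-υ)
      ... | inj₂ (there (there w∈)) =
        trans (cong₂ _·_ (trans ([,]-comm x _) (⟨⟩-centralized _ (L-comm (∈-++⁺ʳ xs w∈)) x∈))
                         (cong₂ _·_ (proj₁ (ws-sq w∈)) (proj₂ (ws-sq w∈))))
              (trans (·-identityˡ _) (square-square _))
    y∈T : y ∈G Tor C
    y∈T = proj₂ (T-gen y) (⟨⟩-mono (λ s∈ → subst (_ ∈_) (List.++-identityʳ xs) s∈) (proj₁ (Z-gen y) y∈Z))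
      where
      y∈Z = ∈Z-intro (·∈C (⟨⟩⊆C L⊆C x∈) (·∈C (hs⊆C ∈₁) (generator∈ C-gen (∈-++⁺ʳ xs ∈₂))))
                     λ c c∈C → [,]≡e⇒comm y c (⟨⟩-centralized y [y,generator]≡e (proj₁ (C-gen c) c∈C))
    z₂≡ : z₁ ⁻¹ · (x ⁻¹ · y) ≡ z₂
    z₂≡ = begin
      z₁ ⁻¹ · (x ⁻¹ · (x · (z₁ · z₂))) ≡⟨ cong (z₁ ⁻¹ ·_) (sym (·-assoc (x ⁻¹) x _)) ⟩
      z₁ ⁻¹ · (x ⁻¹ · x · (z₁ · z₂))   ≡⟨ cong (λ t → z₁ ⁻¹ · (t · (z₁ · z₂))) (·-inverseˡ x) ⟩
      z₁ ⁻¹ · (e · (z₁ · z₂))          ≡⟨ cong (z₁ ⁻¹ ·_) (·-identityˡ _) ⟩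
      z₁ ⁻¹ · (z₁ · z₂)                ≡⟨ sym (·-assoc (z₁ ⁻¹) z₁ z₂) ⟩
      z₁ ⁻¹ · z₁ · z₂                  ≡⟨ cong (_· z₂) (·-inverseˡ z₁) ⟩
      e · z₂                           ≡⟨ ·-identityˡ z₂ ⟩
      z₂                               ∎
    L-preserve : ∀ {s} → s ∈ xs ++ ws → Preserves hs s
    L-preserve s∈ with ∈-++⁻ xs s∈
    ... | inj₁ s∈xs = T-preserves hs (xs⊆T s∈xs)
    ... | inj₂ s∈ws = factor-preserves hs hs⊆C (there s∈ws)
    C-generators-preserve : ∀ {s} → s ∈ xs ++ z₁ ∷ z₂ ∷ ws → Preserves hs s
    C-generators-preserve s∈ with ∈-++⁻ xs s∈
    ... | inj₁ s∈xs = T-preserves hs (xs⊆T s∈xs)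
    ... | inj₂ ∈₁ = factor-preserves hs hs⊆C ∈₁
    ... | inj₂ ∈₂ =
      subst (Preserves hs) z₂≡
        (preserves-· hs (preserves-⁻¹ hs (hs⊆C ∈₁) (factor-preserves hs hs⊆C ∈₁))
          (preserves-· hs (preserves-⁻¹ hs (⟨⟩⊆C L⊆C x∈) (⟨⟩-preserves hs L⊆C L-preserve x∈)) (T-preserves hs y∈T)))
    ... | inj₂ (there (there s∈ws)) = factor-preserves hs hs⊆C (there s∈ws)

  shape2-good : ∀ {xs z₁ z₂ ws} → NormGens C xs [] (z₁ ∷ z₂ ∷ ws) → sq z₁ ≡ u → sq z₂ ≡ u → [ z₁ , z₂ ] ≡ u →
                (∀ w → w ∈ ws → ([ z₁ , w ] ≡ sq w) × ([ z₂ , w ] ≡ sq w)) →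
                (∀ w w' → w ∈ ws → w' ∈ ws → [ w , w' ] ≡ e) →
                IsAbelianWithoutSqrtU C (R xs (z₁ · z₂ ∷ ws))
  shape2-good {xs} {z₁} {z₂} {ws} (C-gen , T-gen , _ , Z-gen , Z-card , C-card) z₁²≡u z₂²≡u [z₁,z₂]≡u ws-sq ws-comm =
    good-via xs _ (subst (_⊆ xs ++ ws) (sym (Rgens-sqrt-u xs ws (≡u⇒==u z₁z₂²≡u))) (λ s∈ → s∈))
      (++⊆C xs⊆T λ w∈ → generator∈ C-gen (∈-++⁺ʳ xs (there (there w∈)))) L-comm
      (z₂-redundant T-gen C-gen Z-gen
         (trans C-card (cong (2 ^ length (z₁ ∷ z₂ ∷ ws) *_) (trans Z-card (ℕ.*-identityˡ _))))
         [z₁,z₂]≡u (λ w∈ → ws-sq _ w∈) L-comm)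
    where
    xs⊆T = generator∈ T-gen
    L-comm = ++-commuting xs⊆T (ws-comm _ _)
    z₁z₂²≡u : sq (z₁ · z₂) ≡ u
    z₁z₂²≡u = begin
      sq (z₁ · z₂)                 ≡⟨ sq-· z₁ z₂ ⟩
      sq z₁ · sq z₂ · [ z₁ , z₂ ]  ≡⟨ cong₂ (λ a b → a · b · [ z₁ , z₂ ]) z₁²≡u z₂²≡u ⟩
      u · u · [ z₁ , z₂ ]          ≡⟨ cong₂ _·_ square-υ [z₁,z₂]≡u ⟩
      e · u                        ≡⟨ ·-identityˡ u ⟩
      u                            ∎

  standard-good : ∀ {xs rs ss} → Standard C xs rs ss → IsAbelianWithoutSqrtU C (R xs rs)
  standard-good (shape1 ng _ rs-gen C-card sqrt-u-first)       = shape1-good ng rs-gen C-card sqrt-u-first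
  standard-good (shape2 ng z₁² z₂² [z₁,z₂] ws-sq ws-comm)     = shape2-good ng z₁² z₂² [z₁,z₂] ws-sq ws-comm
  standard-good (shape3 ng _ u∉ _ ws-comm)                     = shape3-good ng u∉ ws-comm
  standard-good (shape4 ng _ _ z₁²≢u)                          = shape4-good ng z₁²≢u
  standard-good (shape4* ng _ _ z₁²≢u)                         = shape4*-good ng z₁²≢u
  standard-good (shape5 ng z₁² _ _ u≢z₃² z₃²≡z₄² z₄² _ _ _ _) = shape5-good ng z₁² u≢z₃² z₃²≡z₄² z₄²

mainTheorem4 :
    (k1 k2 k3 m : ℕ) (C : SubsetG {k1} {k2} {k3})
    → IsSubgroup C
    → k1 + 2 * k2 + 4 * k3 ≡ 2 ^ m
    → IsHadamardCode (2 ^ m) (ΦImage C)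
    → (xs rs ss : List (G k1 k2 k3)) → Standard C xs rs ss
    → (a b : G k1 k2 k3)
    → R xs rs a → R xs rs b
    → a ∉G Tor C → b ∉G Tor C → (b · a ⁻¹) ∉G Tor C
    → ((sq a ≢ e × sq a ≢ u) × (sq b ≢ e × sq b ≢ u) × (sq (a · b) ≢ e × sq (a · b) ≢ u)
        × wt (sq a) ≡ 2 ^ m / 2 × wt (sq b) ≡ 2 ^ m / 2 × wt (sq (a · b)) ≡ 2 ^ m / 2)
      × (wt ⟪ a ∶ b ⟫ ≡ 2 ^ m / 4 × ⟪ a ∶ b ⟫ ∉G C)
      × ((a' b' : G k1 k2 k3)
          → R xs rs a' → R xs rs b'
          → a' ∉G Tor C → b' ∉G Tor C → (b' · a' ⁻¹) ∉G Tor C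
          → ¬ (a' ≡ a × b' ≡ b) → ¬ (a' ≡ b × b' ≡ a)
          → ((x y : G k1 k2 k3) → x ∈ (a ∷ b ∷ a' ∷ b' ∷ []) → y ∈ (a ∷ b ∷ a' ∷ b' ∷ [])
              → x ≢ y → (y · x ⁻¹) ∉G Tor C)
          → ⟪ a ∶ b ⟫ ≢ ⟪ a' ∶ b' ⟫)
mainTheorem4 k1 k2 k3 m C C-subgroup length≡n hadamard xs rs ss standard a b a∈R b∈R a∉T b∉T ba⁻¹∉T =
    (proj₁ a² , proj₁ b² , proj₁ ab² , proj₂ a² , proj₂ b² , proj₂ ab²)
  , (quarter 4wt≡n , quarter-weight∉C 4wt≡n)
  , swapper-injective R-good a∈R b∈R a∉T b∉T ba⁻¹∉T
  where
  open HadamardSubgroup m C C-subgroup length≡n hadamard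
  R-good = StandardGenerators.standard-good C C-subgroup u≢e standard
  a²  = square-balanced R-good a∈R a∉T
  b²  = square-balanced R-good b∈R b∉T
  ab² = square-balanced R-good (IsAbelianWithoutSqrtU.·-closed R-good a∈R b∈R) (·∉T R-good a∈R b∈R ba⁻¹∉T)
  4wt≡n = swapper-quarter-weight R-good a∈R b∈R a∉T b∉T ba⁻¹∉T
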